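{- Let $H$ be a nonempty graph (i.e., with at least one edge), and let $m \leq e(H)$ be a positive integer. Then there exists a spanning subgraph $H' \subseteq H$ with exactly $m$ edges satisfying: (S1) $\Delta(H') - \delta(H') \leq \Delta(H) - \delta(H) + 2$; (S2) $\Delta(H \setminus H') \leq (\Delta(H) + 1)\frac{e(H) - m}{e(H)} + 1$.
   Context: $e(H)$ is the number of edges, $\Delta$ and $\delta$ denote maximum and minimum degree, and $H \setminus H'$ denotes the spanning subgraph of $H$ with edge set $E(H)\setminus E(H')$. -}

module Defs where

open import Data.Bool using (Bool; true; false; _∧_; not; if_then_else_)
open import Data.Nat using (ℕ; zero; suc; _+_; _⊔_; _⊓_; _<ᵇ_)
open import Data.Fin using (Fin; toℕ)
open import Data.List using (List; []; _∷_; map; foldr; allFin)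
open import Data.Nat.ListAction using (sum)
open import Relation.Binary.PropositionalEquality using (_≡_; refl; cong₂; cong)

record Graph (n : ℕ) : Set where
  field
    adj    : Fin n → Fin n → Bool
    sym    : ∀ u v → adj u v ≡ adj v u
    irrefl : ∀ v → adj v v ≡ false
open Graph public

count : {A : Set} → (A → Bool) → List A → ℕ
count p []       = 0
count p (x ∷ xs) = (if p x then 1 else 0) + count p xs

deg : {n : ℕ} → Graph n → Fin n → ℕ
deg {n} G u = count (adj G u) (allFin n)

e : {n : ℕ} → Graph n → ℕ
e {n} G = sum (map (λ u → count (λ v → adj G u v ∧ (toℕ u <ᵇ toℕ v)) (allFin n)) (allFin n))

Δ : {n : ℕ} → Graph n → ℕ
Δ {n} G = foldr _⊔_ 0 (map (deg G) (allFin n))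

δ : {n : ℕ} → Graph n → ℕ
δ {zero}  G = 0
δ {suc n} G = foldr _⊓_ (deg G Fin.zero) (map (deg G) (allFin (suc n)))
  where import Data.Fin as Fin

_⊆_ : {n : ℕ} → Graph n → Graph n → Set
_⊆_ {n} H' H = ∀ (u v : Fin n) → adj H' u v ≡ true → adj H u v ≡ true

_∖_ : {n : ℕ} → Graph n → Graph n → Graph n
adj    (H ∖ H') u v = adj H u v ∧ not (adj H' u v)
sym    (H ∖ H') u v = cong₂ _∧_ (sym H u v) (cong not (sym H' u v))
irrefl (H ∖ H') v rewrite irrefl H v = refl

{-# OPTIONS --safe #-}

-- Properly colour the edges of H with Δ(H) + 1 colours (Vizing's theorem). Delete whole colour
-- classes, heaviest first, while at most e(H) − m edges are deleted, and then enough edges of the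
-- next class to delete exactly e(H) − m edges. If j classes were deleted entirely, every vertex
-- meets the deleted edges in at most j + 1 colours, so Δ(H ∖ H′) ≤ j + 1, and the j heaviest
-- classes hold at least a j/(Δ(H) + 1) share of all edges, so j e(H) ≤ (Δ(H) + 1)(e(H) − m);
-- together this is (S2). The kept graph H′ uses only the Δ(H) + 1 − j colours that were not
-- deleted entirely, so Δ(H′) ≤ Δ(H) + 1 − j, and every vertex loses at most j + 1 edges, so
-- δ(H′) ≥ δ(H) − j − 1; together this is (S1).
--
-- Vizing's theorem is proved by the fan argument: an uncoloured edge x y₀ gets a colour once the
-- colours are rotated along a maximal fan at x, possibly after swapping two colours on an
-- alternating (Kempe) walk.

module Submission where

open import Data.Bool using (Bool; true; false; _∧_; _∨_; not; if_then_else_; T)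
open import Data.Bool.Properties
  using ( ∧-conicalˡ; ∧-conicalʳ; ∧-assoc; ∧-comm; ∧-zeroʳ; ∧-identityʳ; ∨-conicalʳ; ∨-zeroʳ; ∨-identityʳ
        ; not-injective; ¬-not; if-cong)
  renaming (_≟_ to _≟ᵇ_)
open import Data.Empty using (⊥; ⊥-elim)
open import Data.Fin using (Fin; zero; suc; toℕ; fromℕ<)
open import Data.Fin.Properties using (_≟_; any?; all?; ¬∀⟶∃¬; pigeonhole; toℕ≤pred[n]; toℕ-fromℕ<; toℕ-injective)
import Data.Fin.Properties as Finₚ
open import Data.Fin.Permutation.Components using (transpose; transpose-inverse)
open import Data.List using (map; foldr; tabulate; allFin)
open import Data.Maybe using (Maybe; just; nothing; _>>=_)
import Data.Maybe
open import Data.Maybe.Properties using (just-injective)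
import Data.Maybe.Properties
open import Data.Nat using (ℕ; zero; suc; _+_; _*_; _∸_; _≤_; _<_; _⊔_; _⊓_; _<ᵇ_; z≤n; s≤s; z<s; _<?_; _≤?_)
open import Data.Nat.Properties hiding (_≟_)
open import Data.Nat.Tactic.RingSolver using (solve-∀)
open import Algebra.Properties.CommutativeSemigroup *-commutativeSemigroup using (x∙yz≈y∙xz)
open import Algebra.Properties.Semiring.Sum +-*-semiring
  using (sum; sum-syntax; sum-cong-≗; ∑-distrib-+; ∑-comm; sum-replicate-zero; *-distribˡ-sum; *-distribʳ-sum)
open import Data.Product using (Σ; ∃-syntax; Σ-syntax; _×_; _,_; proj₁; proj₂; uncurry)
open import Data.Sum using (_⊎_; inj₁; inj₂; [_,_]′)
import Data.Sum
import Data.Vec.Functional as Vector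
open import Function using (_∘_; case_of_)
open import Function.Bundles using (mk⇔)
open import Relation.Binary.Definitions using (tri<; tri≈; tri>)
open import Relation.Binary.PropositionalEquality
open import Relation.Nullary using (¬_; Dec; yes; no; does)
open import Relation.Nullary.Decidable using (dec-true; dec-false; does-⇔; map′; _×-dec_; _⊎-dec_; dec⇒maybe)
open import Defs hiding (sym)

𝟙 : Bool → ℕ
𝟙 b = if b then 1 else 0

true-or-false : ∀ b → b ≡ true ⊎ b ≡ false
true-or-false true  = inj₁ refl
true-or-false false = inj₂ refl

from-does : ∀ {P : Set} (d : Dec P) → does d ≡ true → P
from-does (yes p) _ = p

∨-true : ∀ {a b} → a ∨ b ≡ true → a ≡ true ⊎ b ≡ true
∨-true {true}  _ = inj₁ refl
∨-true {false} b = inj₂ b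

𝟙-∨ : ∀ {a b} → (b ≡ true → a ≡ false) → 𝟙 (a ∨ b) ≡ 𝟙 a + 𝟙 b
𝟙-∨ {true}  {true}  b⇒¬a with () ← b⇒¬a refl
𝟙-∨ {true}  {false} _ = refl
𝟙-∨ {false}         _ = refl

∣_∣ : ∀ {n} → (Fin n → Bool) → ℕ
∣_∣ {n} p = ∑[ i < n ] 𝟙 (p i)

sumOver : ∀ {n} → (Fin n → Bool) → (Fin n → ℕ) → ℕ
sumOver {n} S f = ∑[ i < n ] (𝟙 (S i) * f i)

syntax sumOver S (λ i → x) = ∑[ i ∈ S ] x

sum-mono-≤ : ∀ {n} {f g : Fin n → ℕ} → (∀ i → f i ≤ g i) → sum f ≤ sum g
sum-mono-≤ {zero}  f≤g = z≤n
sum-mono-≤ {suc n} f≤g = +-mono-≤ (f≤g zero) (sum-mono-≤ (f≤g ∘ suc))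

sum-mono-< : ∀ {n} {f g : Fin n → ℕ} → (∀ i → f i ≤ g i) → ∀ i → f i < g i → sum f < sum g
sum-mono-< f≤g zero    fi<gi = +-mono-<-≤ fi<gi (sum-mono-≤ (f≤g ∘ suc))
sum-mono-< f≤g (suc i) fi<gi = +-mono-≤-< (f≤g zero) (sum-mono-< (f≤g ∘ suc) i fi<gi)

term≤sum : ∀ {n} (f : Fin n → ℕ) i → f i ≤ sum f
term≤sum f zero    = m≤m+n _ _
term≤sum f (suc i) = ≤-trans (term≤sum (f ∘ suc) i) (m≤n+m _ (f zero))

sum-positive : ∀ {n} (f : Fin n → ℕ) → 0 < sum f → ∃[ i ] 0 < f i
sum-positive {suc n} f 0<∑ with f zero in eq
... | suc _ = zero , subst (0 <_) (sym eq) z<s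
... | zero  = let i , 0<fi = sum-positive (f ∘ suc) 0<∑ in suc i , 0<fi

∑-sift : ∀ {n} (i : Fin n) (f : Fin n → ℕ) → ∑[ j < n ] (𝟙 (does (i ≟ j)) * f j) ≡ f i
∑-sift {suc n} zero    f =
  trans (cong₂ _+_ (+-identityʳ (f zero)) (sum-replicate-zero n)) (+-identityʳ (f zero))
∑-sift {suc n} (suc i) f = ∑-sift i (f ∘ suc)

∣∣≡0 : ∀ {n} {p : Fin n → Bool} → (∀ i → p i ≡ false) → ∣ p ∣ ≡ 0
∣∣≡0 {n} p≡false = trans (sum-cong-≗ (cong 𝟙 ∘ p≡false)) (sum-replicate-zero n)

∣true∣ : ∀ n → ∣ (λ (_ : Fin n) → true) ∣ ≡ n
∣true∣ zero    = refl
∣true∣ (suc n) = cong suc (∣true∣ n)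

∣∣≤n : ∀ {n} (p : Fin n → Bool) → ∣ p ∣ ≤ n
∣∣≤n {zero}  p = z≤n
∣∣≤n {suc n} p = +-mono-≤ (𝟙≤1 (p zero)) (∣∣≤n (p ∘ suc))
  where
  𝟙≤1 : ∀ b → 𝟙 b ≤ 1
  𝟙≤1 true  = ≤-refl
  𝟙≤1 false = z≤n

𝟙-mono : ∀ {b c} → (b ≡ true → c ≡ true) → 𝟙 b ≤ 𝟙 c
𝟙-mono {true}  b⇒c rewrite b⇒c refl = ≤-refl
𝟙-mono {false} b⇒c = z≤n

∣∣-mono : ∀ {n} {p q : Fin n → Bool} → (∀ i → p i ≡ true → q i ≡ true) → ∣ p ∣ ≤ ∣ q ∣
∣∣-mono p⇒q = sum-mono-≤ (λ i → 𝟙-mono (p⇒q i))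

∣∣-mono-< : ∀ {n} {p q : Fin n → Bool} → (∀ i → p i ≡ true → q i ≡ true) →
            ∀ i → p i ≡ false → q i ≡ true → ∣ p ∣ < ∣ q ∣
∣∣-mono-< p⇒q i pi qi = sum-mono-< (λ j → 𝟙-mono (p⇒q j)) i (subst₂ (λ a b → 𝟙 a < 𝟙 b) (sym pi) (sym qi) z<s)

∣∣-complement : ∀ {n} (p : Fin n → Bool) → ∣ p ∣ + ∣ not ∘ p ∣ ≡ n
∣∣-complement {n} p = begin
  ∣ p ∣ + ∣ not ∘ p ∣                  ≡⟨ ∑-distrib-+ (𝟙 ∘ p) (𝟙 ∘ not ∘ p) ⟨
  ∑[ i < n ] (𝟙 (p i) + 𝟙 (not (p i))) ≡⟨ sum-cong-≗ (𝟙+𝟙-not ∘ p) ⟩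
  ∣ (λ (_ : Fin n) → true) ∣           ≡⟨ ∣true∣ n ⟩
  n                                    ∎
  where
  open ≡-Reasoning
  𝟙+𝟙-not : ∀ b → 𝟙 b + 𝟙 (not b) ≡ 1
  𝟙+𝟙-not true  = refl
  𝟙+𝟙-not false = refl

∣∣≤1 : ∀ {n} {p : Fin n → Bool} → (∀ i j → p i ≡ true → p j ≡ true → i ≡ j) → ∣ p ∣ ≤ 1
∣∣≤1 {zero}          _    = z≤n
∣∣≤1 {suc n} {p} unique with p zero in p₀
... | true  = ≤-reflexive (cong suc (∣∣≡0 rest))
  where
  rest : ∀ i → p (suc i) ≡ false
  rest i with p (suc i) in pᵢ
  ... | true  with () ← unique zero (suc i) p₀ pᵢ
  ... | false = refl
... | false = ∣∣≤1 λ i j pᵢ pⱼ → Finₚ.suc-injective (unique (suc i) (suc j) pᵢ pⱼ)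

𝟙-∧ : ∀ b c → 𝟙 (b ∧ c) ≡ 𝟙 b * 𝟙 c
𝟙-∧ true  c = sym (+-identityʳ (𝟙 c))
𝟙-∧ false c = refl

∣∣-fibres : ∀ {m n} (f : Fin m → Fin n) (p : Fin m → Bool) →
            ∣ p ∣ ≡ ∑[ j < n ] ∣ (λ i → does (f i ≟ j) ∧ p i) ∣
∣∣-fibres {m} {n} f p = begin
  ∑[ i < m ] 𝟙 (p i)                        ≡⟨ sum-cong-≗ (λ i → ∑-sift (f i) (λ _ → 𝟙 (p i))) ⟨
  ∑[ i < m ] ∑[ j < n ] fibre i j           ≡⟨ ∑-comm fibre ⟩
  ∑[ j < n ] ∑[ i < m ] fibre i j           ≡⟨ sum-cong-≗ (λ j → sum-cong-≗ (λ i → 𝟙-∧ (does (f i ≟ j)) (p i))) ⟨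
  ∑[ j < n ] ∣ (λ i → does (f i ≟ j) ∧ p i) ∣ ∎
  where
  open ≡-Reasoning
  fibre : Fin m → Fin n → ℕ
  fibre i j = 𝟙 (does (f i ≟ j)) * 𝟙 (p i)

∣∣-injection : ∀ {m n} {p : Fin m → Bool} {q : Fin n → Bool} (f : Fin m → Fin n) →
               (∀ i j → p i ≡ true → p j ≡ true → f i ≡ f j → i ≡ j) →
               (∀ i → p i ≡ true → q (f i) ≡ true) → ∣ p ∣ ≤ ∣ q ∣
∣∣-injection {p = p} {q} f injective into = begin
  ∣ p ∣                                          ≡⟨ ∣∣-fibres f p ⟩
  ∑[ j < _ ] ∣ (λ i → does (f i ≟ j) ∧ p i) ∣    ≤⟨ sum-mono-≤ fibre≤ ⟩
  ∣ q ∣                                          ∎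
  where
  open ≤-Reasoning
  fibre≤ : ∀ j → ∣ (λ i → does (f i ≟ j) ∧ p i) ∣ ≤ 𝟙 (q j)
  fibre≤ j with q j in qⱼ
  ... | true  = ∣∣≤1 λ i i′ h h′ → injective i i′ (∧-conicalʳ _ _ h) (∧-conicalʳ _ _ h′)
                  (trans (fibre (∧-conicalˡ _ _ h)) (sym (fibre (∧-conicalˡ _ _ h′))))
    where
    fibre : ∀ {i} → does (f i ≟ j) ≡ true → f i ≡ j
    fibre {i} h with f i ≟ j
    ... | yes fi≡j = fi≡j
  ... | false = ≤-reflexive (∣∣≡0 empty)
    where
    empty : ∀ i → (does (f i ≟ j) ∧ p i) ≡ false
    empty i with f i ≟ j | p i in pᵢ
    ... | yes refl | true  with () ← trans (sym (into i pᵢ)) qⱼ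
    ... | yes refl | false = refl
    ... | no _     | _     = refl

insert : ∀ {n} → Fin n → (Fin n → Bool) → Fin n → Bool
insert i S j = does (i ≟ j) ∨ S j

𝟙-insert : ∀ {n} (S : Fin n → Bool) {i} → S i ≡ false → ∀ j → 𝟙 (insert i S j) ≡ 𝟙 (S j) + 𝟙 (does (i ≟ j))
𝟙-insert S {i} Sᵢ j with i ≟ j
... | yes refl rewrite Sᵢ = refl
... | no _     = sym (+-identityʳ (𝟙 (S j)))

∑∈-insert : ∀ {n} (S : Fin n → Bool) {i} (f : Fin n → ℕ) → S i ≡ false →
            ∑[ j ∈ insert i S ] f j ≡ ∑[ j ∈ S ] f j + f i
∑∈-insert {n} S {i} f Sᵢ = begin
  ∑[ j < n ] (𝟙 (insert i S j) * f j)                        ≡⟨ sum-cong-≗ (λ j → cong (_* f j) (𝟙-insert S Sᵢ j)) ⟩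
  ∑[ j < n ] ((𝟙 (S j) + 𝟙 (does (i ≟ j))) * f j)            ≡⟨ sum-cong-≗ (λ j → *-distribʳ-+ (f j) (𝟙 (S j)) _) ⟩
  ∑[ j < n ] (𝟙 (S j) * f j + 𝟙 (does (i ≟ j)) * f j)        ≡⟨ ∑-distrib-+ (λ j → 𝟙 (S j) * f j) _ ⟩
  ∑[ j ∈ S ] f j + ∑[ j < n ] (𝟙 (does (i ≟ j)) * f j)       ≡⟨ cong (∑[ j ∈ S ] f j +_) (∑-sift i f) ⟩
  ∑[ j ∈ S ] f j + f i                                       ∎
  where open ≡-Reasoning

∑∈-const : ∀ {n} (S : Fin n → Bool) c → ∑[ j ∈ S ] c ≡ ∣ S ∣ * c
∑∈-const S c = sym (*-distribʳ-sum c (𝟙 ∘ S))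

∣∣-insert : ∀ {n} (S : Fin n → Bool) {i} → S i ≡ false → ∣ insert i S ∣ ≡ suc ∣ S ∣
∣∣-insert S {i} Sᵢ = begin
  ∣ insert i S ∣            ≡⟨ *-identityʳ _ ⟨
  ∣ insert i S ∣ * 1        ≡⟨ ∑∈-const (insert i S) 1 ⟨
  ∑[ j ∈ insert i S ] 1     ≡⟨ ∑∈-insert S (λ _ → 1) Sᵢ ⟩
  ∑[ j ∈ S ] 1 + 1          ≡⟨ cong (_+ 1) (trans (∑∈-const S 1) (*-identityʳ _)) ⟩
  ∣ S ∣ + 1                 ≡⟨ +-comm ∣ S ∣ 1 ⟩
  suc ∣ S ∣                 ∎
  where open ≡-Reasoning

∑-split : ∀ {n} (S : Fin n → Bool) (f : Fin n → ℕ) → sum f ≡ ∑[ j ∈ S ] f j + ∑[ j ∈ not ∘ S ] f j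
∑-split S f = trans (sum-cong-≗ (λ j → split (S j) (f j))) (∑-distrib-+ (λ j → 𝟙 (S j) * f j) _)
  where
  split : ∀ b x → x ≡ 𝟙 b * x + 𝟙 (not b) * x
  split true  x = sym (trans (+-identityʳ _) (+-identityʳ x))
  split false x = sym (+-identityʳ x)

∑∈-mono-≤ : ∀ {n} {S : Fin n → Bool} {f g : Fin n → ℕ} → (∀ j → S j ≡ true → f j ≤ g j) →
            ∑[ j ∈ S ] f j ≤ ∑[ j ∈ S ] g j
∑∈-mono-≤ {S = S} f≤g = sum-mono-≤ pointwise
  where
  pointwise : ∀ j → 𝟙 (S j) * _ ≤ 𝟙 (S j) * _
  pointwise j with S j in Sⱼ
  ... | true  = +-monoˡ-≤ 0 (f≤g j Sⱼ)
  ... | false = z≤n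

max : ∀ {n} → (Fin n → ℕ) → ℕ
max = Vector.foldr _⊔_ 0

≤max : ∀ {n} (f : Fin n → ℕ) i → f i ≤ max f
≤max f zero    = m≤m⊔n _ _
≤max f (suc i) = ≤-trans (≤max (f ∘ suc) i) (m≤n⊔m _ _)

max-least : ∀ {n} {f : Fin n → ℕ} {b} → (∀ i → f i ≤ b) → max f ≤ b
max-least {zero}  f≤b = z≤n
max-least {suc n} f≤b = ⊔-lub (f≤b zero) (max-least (f≤b ∘ suc))

min : ∀ {n} → ℕ → (Fin n → ℕ) → ℕ
min b = Vector.foldr _⊓_ b

min≤ : ∀ {n} b (f : Fin n → ℕ) i → min b f ≤ f i
min≤ b f zero    = m⊓n≤m _ _
min≤ b f (suc i) = ≤-trans (m⊓n≤n _ _) (min≤ b (f ∘ suc) i)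

min-greatest : ∀ {n} {b} {f : Fin n → ℕ} {c} → c ≤ b → (∀ i → c ≤ f i) → c ≤ min b f
min-greatest {zero}  c≤b c≤f = c≤b
min-greatest {suc n} c≤b c≤f = ⊓-glb (c≤f zero) (min-greatest c≤b (c≤f ∘ suc))

argmax : ∀ {n} → Fin n → (f : Fin n → ℕ) → ∃[ i ] ∀ j → f j ≤ f i
argmax {suc zero}    _ f = zero , λ { zero → ≤-refl }
argmax {suc (suc n)} _ f with argmax zero (f ∘ suc)
... | i , ≤fᵢ with ≤-total (f zero) (f (suc i))
...   | inj₁ f₀≤ = suc i , λ { zero → f₀≤ ; (suc j) → ≤fᵢ j }
...   | inj₂ ≤f₀ = zero  , λ { zero → ≤-refl ; (suc j) → ≤-trans (≤fᵢ j) ≤f₀ }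

foldr-map-tabulate : ∀ {A B C : Set} {n} (_∙_ : B → C → C) (z : C) (f : A → B) (g : Fin n → A) →
                     foldr _∙_ z (map f (tabulate g)) ≡ Vector.foldr _∙_ z (f ∘ g)
foldr-map-tabulate {n = zero}  _∙_ z f g = refl
foldr-map-tabulate {n = suc n} _∙_ z f g = cong (f (g zero) ∙_) (foldr-map-tabulate _∙_ z f (g ∘ suc))

count-tabulate : ∀ {A : Set} {n} (p : A → Bool) (g : Fin n → A) → count p (tabulate g) ≡ ∣ p ∘ g ∣
count-tabulate {n = zero}  p g = refl
count-tabulate {n = suc n} p g = cong (𝟙 (p (g zero)) +_) (count-tabulate p (g ∘ suc))

adj-≢ : ∀ {n} (G : Graph n) {u v} → adj G u v ≡ true → u ≢ v
adj-≢ G {u} uv refl with () ← trans (sym uv) (irrefl G u)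

deg≡∣adj∣ : ∀ {n} (G : Graph n) u → deg G u ≡ ∣ adj G u ∣
deg≡∣adj∣ G u = count-tabulate (adj G u) (λ v → v)

deg≤Δ : ∀ {n} (G : Graph n) u → deg G u ≤ Δ G
deg≤Δ {n} G u = subst (deg G u ≤_) (sym (foldr-map-tabulate _⊔_ 0 (deg G) (λ v → v))) (≤max (deg G) u)

Δ-least : ∀ {n} (G : Graph n) {b} → (∀ u → deg G u ≤ b) → Δ G ≤ b
Δ-least G deg≤b = subst (_≤ _) (sym (foldr-map-tabulate _⊔_ 0 (deg G) (λ v → v))) (max-least deg≤b)

δ≤deg : ∀ {n} (G : Graph n) u → δ G ≤ deg G u
δ≤deg {suc n} G u =
  subst (_≤ deg G u) (sym (foldr-map-tabulate _⊓_ (deg G zero) (deg G) (λ v → v))) (min≤ (deg G zero) (deg G) u)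

δ-greatest : ∀ {n} (G : Graph (suc n)) {b} → (∀ u → b ≤ deg G u) → b ≤ δ G
δ-greatest G b≤deg =
  subst (_ ≤_) (sym (foldr-map-tabulate _⊓_ (deg G zero) (deg G) (λ v → v))) (min-greatest (b≤deg zero) b≤deg)

edges : ∀ {n} → (Fin n → Fin n → Bool) → ℕ
edges {n} r = ∑[ u < n ] ∑[ v < n ] 𝟙 (r u v ∧ (toℕ u <ᵇ toℕ v))

e≡edges : ∀ {n} (G : Graph n) → e G ≡ edges (adj G)
e≡edges {n} G = trans (foldr-map-tabulate _+_ 0 (λ u → count (forward u) (allFin n)) (λ u → u))
                      (sum-cong-≗ (λ u → count-tabulate (forward u) (λ v → v)))
  where
  forward : Fin n → Fin n → Bool
  forward u v = adj G u v ∧ (toℕ u <ᵇ toℕ v)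

edges-+ : ∀ {n} {r r₁ r₂ : Fin n → Fin n → Bool} → (∀ u v → 𝟙 (r u v) ≡ 𝟙 (r₁ u v) + 𝟙 (r₂ u v)) →
          edges r ≡ edges r₁ + edges r₂
edges-+ {n} {r} {r₁} {r₂} split = begin
  ∑[ u < n ] ∑[ v < n ] at r u v                       ≡⟨ sum-cong-≗ (λ u → sum-cong-≗ (pointwise u)) ⟩
  ∑[ u < n ] ∑[ v < n ] (at r₁ u v + at r₂ u v)        ≡⟨ sum-cong-≗ (λ u → ∑-distrib-+ (at r₁ u) (at r₂ u)) ⟩
  ∑[ u < n ] (sum (at r₁ u) + sum (at r₂ u))           ≡⟨ ∑-distrib-+ (sum ∘ at r₁) (sum ∘ at r₂) ⟩
  edges r₁ + edges r₂                                  ∎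
  where
  open ≡-Reasoning
  l : Fin n → Fin n → Bool
  l u v = toℕ u <ᵇ toℕ v
  at : (Fin n → Fin n → Bool) → Fin n → Fin n → ℕ
  at r u v = 𝟙 (r u v ∧ l u v)
  pointwise : ∀ u v → 𝟙 (r u v ∧ l u v) ≡ 𝟙 (r₁ u v ∧ l u v) + 𝟙 (r₂ u v ∧ l u v)
  pointwise u v = begin
    𝟙 (r u v ∧ l u v)                                ≡⟨ 𝟙-∧ (r u v) (l u v) ⟩
    𝟙 (r u v) * 𝟙 (l u v)                            ≡⟨ cong (_* 𝟙 (l u v)) (split u v) ⟩
    (𝟙 (r₁ u v) + 𝟙 (r₂ u v)) * 𝟙 (l u v)            ≡⟨ *-distribʳ-+ (𝟙 (l u v)) (𝟙 (r₁ u v)) _ ⟩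
    𝟙 (r₁ u v) * 𝟙 (l u v) + 𝟙 (r₂ u v) * 𝟙 (l u v)  ≡⟨ cong₂ _+_ (𝟙-∧ (r₁ u v) _) (𝟙-∧ (r₂ u v) _) ⟨
    𝟙 (r₁ u v ∧ l u v) + 𝟙 (r₂ u v ∧ l u v)          ∎

0<e⇒edge : ∀ {n} (G : Graph n) → 0 < e G → ∃[ u ] ∃[ v ] adj G u v ≡ true × toℕ u < toℕ v
0<e⇒edge G 0<e with sum-positive _ (subst (0 <_) (e≡edges G) 0<e)
... | u , 0<deg with sum-positive _ 0<deg
...   | v , 0<𝟙 with adj G u v in uv | toℕ u <ᵇ toℕ v in u<ᵇv
...     | true | true = u , v , uv , <ᵇ⇒< (toℕ u) (toℕ v) (subst T (sym u<ᵇv) _)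

forward-edge⇒0<e : ∀ {n} (G : Graph n) {u v} → adj G u v ≡ true → toℕ u < toℕ v → 0 < e G
forward-edge⇒0<e G {u} {v} uv u<v =
  subst (0 <_) (sym (e≡edges G)) (≤-trans positive (≤-trans (term≤sum _ v) (term≤sum _ u)))
  where
  positive : 0 < 𝟙 (adj G u v ∧ (toℕ u <ᵇ toℕ v))
  positive rewrite uv | dec-true (toℕ u <? toℕ v) u<v = z<s

edge⇒0<e : ∀ {n} (G : Graph n) {u v} → adj G u v ≡ true → 0 < e G
edge⇒0<e G {u} {v} uv with <-cmp (toℕ u) (toℕ v)
... | tri< u<v _ _  = forward-edge⇒0<e G uv u<v
... | tri≈ _ same _ = ⊥-elim (adj-≢ G uv (toℕ-injective same))
... | tri> _ _ v<u  = forward-edge⇒0<e G (trans (Graph.sym G v u) uv) v<u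

𝟙-∖ : ∀ {h r} → (r ≡ true → h ≡ true) → 𝟙 h ≡ 𝟙 (h ∧ not r) + 𝟙 r
𝟙-∖ {true}  {true}  _   = refl
𝟙-∖ {true}  {false} _   = refl
𝟙-∖ {false} {true}  r⇒h with () ← r⇒h refl
𝟙-∖ {false} {false} _   = refl

e-∖ : ∀ {n} (H R : Graph n) → R ⊆ H → e H ≡ e (H ∖ R) + e R
e-∖ H R R⊆H = begin
  e H                          ≡⟨ e≡edges H ⟩
  edges (adj H)                ≡⟨ edges-+ (λ u v → 𝟙-∖ (R⊆H u v)) ⟩
  edges (adj (H ∖ R)) + edges (adj R) ≡⟨ cong₂ _+_ (e≡edges (H ∖ R)) (e≡edges R) ⟨
  e (H ∖ R) + e R              ∎
  where open ≡-Reasoning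

deg-∖ : ∀ {n} (H R : Graph n) → R ⊆ H → ∀ u → deg H u ≡ deg (H ∖ R) u + deg R u
deg-∖ H R R⊆H u = begin
  deg H u                          ≡⟨ deg≡∣adj∣ H u ⟩
  ∣ adj H u ∣                      ≡⟨ sum-cong-≗ (λ v → 𝟙-∖ (R⊆H u v)) ⟩
  ∑[ v < _ ] (𝟙 (adj (H ∖ R) u v) + 𝟙 (adj R u v)) ≡⟨ ∑-distrib-+ (𝟙 ∘ adj (H ∖ R) u) (𝟙 ∘ adj R u) ⟩
  ∣ adj (H ∖ R) u ∣ + ∣ adj R u ∣  ≡⟨ cong₂ _+_ (deg≡∣adj∣ (H ∖ R) u) (deg≡∣adj∣ R u) ⟨
  deg (H ∖ R) u + deg R u          ∎
  where open ≡-Reasoning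

∖-⊆ : ∀ {n} (H R : Graph n) → (H ∖ R) ⊆ H
∖-⊆ H R u v = ∧-conicalˡ _ _

∖∖-⊆ : ∀ {n} (H R : Graph n) → (H ∖ (H ∖ R)) ⊆ R
∖∖-⊆ H R u v h with adj H u v | adj R u v
... | true | true = refl

∖-intro : ∀ {n} (H R : Graph n) {u v} → adj H u v ≡ true → adj R u v ≡ false → adj (H ∖ R) u v ≡ true
∖-intro H R {u} {v} uv∈H uv∉R = subst (λ b → adj H u v ∧ not b ≡ true) (sym uv∉R) (trans (∧-identityʳ _) uv∈H)

e-mono : ∀ {n} (A B : Graph n) → A ⊆ B → e A ≤ e B
e-mono A B A⊆B = subst (e A ≤_) (sym (e-∖ B A A⊆B)) (m≤n+m (e A) _)

e-mono-< : ∀ {n} (A B : Graph n) → A ⊆ B → ∀ {u v} → adj B u v ≡ true → adj A u v ≡ false → e A < e B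
e-mono-< A B A⊆B uv∈B uv∉A =
  subst (e A <_) (sym (e-∖ B A A⊆B)) (m<n+m (e A) (edge⇒0<e (B ∖ A) (∖-intro B A uv∈B uv∉A)))

edgeless-∖⇒⊆ : ∀ {n} (H R : Graph n) → ¬ (0 < e (H ∖ R)) → H ⊆ R
edgeless-∖⇒⊆ H R edgeless u v uv∈H =
  [ (λ uv∈R → uv∈R) , (λ uv∉R → ⊥-elim (edgeless (edge⇒0<e (H ∖ R) (∖-intro H R uv∈H uv∉R)))) ]′ (true-or-false (adj R u v))

∖-antitone : ∀ {n} (H R R′ : Graph n) → R ⊆ R′ → (H ∖ R′) ⊆ (H ∖ R)
∖-antitone H R R′ R⊆R′ u v h = [ inside , outside ]′ (true-or-false (adj R u v))
  where
  inside : adj R u v ≡ true → adj H u v ∧ not (adj R u v) ≡ true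
  inside uv∈R with () ← trans (sym (∧-conicalʳ _ _ h)) (cong not (R⊆R′ u v uv∈R))
  outside : adj R u v ≡ false → adj H u v ∧ not (adj R u v) ≡ true
  outside = ∖-intro H R (∧-conicalˡ _ _ h)

IsEdge : ∀ {n} → Fin n → Fin n → Fin n → Fin n → Set
IsEdge x y a b = (a ≡ x × b ≡ y) ⊎ (a ≡ y × b ≡ x)

edge? : ∀ {n} (x y a b : Fin n) → Dec (IsEdge x y a b)
edge? x y a b = (a ≟ x ×-dec b ≟ y) ⊎-dec (a ≟ y ×-dec b ≟ x)

IsEdge-sym : ∀ {n} {x y a b : Fin n} → IsEdge x y a b → IsEdge x y b a
IsEdge-sym (inj₁ (a≡x , b≡y)) = inj₂ (b≡y , a≡x)
IsEdge-sym (inj₂ (a≡y , b≡x)) = inj₁ (b≡x , a≡y)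

edge?-sym : ∀ {n} (x y a b : Fin n) → does (edge? x y a b) ≡ does (edge? x y b a)
edge?-sym x y a b = does-⇔ (mk⇔ IsEdge-sym IsEdge-sym) (edge? x y a b) (edge? x y b a)

edge?-irrefl : ∀ {n} {x y : Fin n} → x ≢ y → ∀ a → does (edge? x y a a) ≡ false
edge?-irrefl x≢y a = dec-false (edge? _ _ a a) λ
  { (inj₁ (a≡x , a≡y)) → x≢y (trans (sym a≡x) a≡y)
  ; (inj₂ (a≡y , a≡x)) → x≢y (trans (sym a≡x) a≡y) }

insertEdge : ∀ {n} (A : Graph n) (x y : Fin n) → x ≢ y → Graph n
adj    (insertEdge A x y x≢y) a b = adj A a b ∨ does (edge? x y a b)
Graph.sym (insertEdge A x y x≢y) a b = cong₂ _∨_ (Graph.sym A a b) (edge?-sym x y a b)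
irrefl (insertEdge A x y x≢y) a rewrite irrefl A a = edge?-irrefl x≢y a

∣≟∣ : ∀ {n} (i : Fin n) → ∣ (λ j → does (i ≟ j)) ∣ ≡ 1
∣≟∣ i = trans (sum-cong-≗ (λ j → sym (*-identityʳ (𝟙 (does (i ≟ j)))))) (∑-sift i (λ _ → 1))

edges-single : ∀ {n} {x y : Fin n} → toℕ x < toℕ y → edges (λ a b → does (edge? x y a b)) ≡ 1
edges-single {n} {x} {y} x<y = begin
  edges (λ a b → does (edge? x y a b))       ≡⟨ sum-cong-≗ (λ a → sum-cong-≗ (pointwise a)) ⟩
  ∑[ a < n ] ∑[ b < n ] (is x a * is y b)    ≡⟨ sum-cong-≗ (λ a → *-distribˡ-sum (is x a) (is y)) ⟨
  ∑[ a < n ] (is x a * ∣ (does ∘ (y ≟_)) ∣)   ≡⟨ sum-cong-≗ (λ a → cong (is x a *_) (∣≟∣ y)) ⟩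
  ∑[ a < n ] (is x a * 1)                    ≡⟨ ∑-sift x (λ _ → 1) ⟩
  1                                          ∎
  where
  open ≡-Reasoning
  is : Fin n → Fin n → ℕ
  is i j = 𝟙 (does (i ≟ j))
  -- does (m <? n) reduces to the test m <ᵇ n used by e.
  pointwise : ∀ a b → 𝟙 (does (edge? x y a b) ∧ (toℕ a <ᵇ toℕ b)) ≡ is x a * is y b
  pointwise a b =
    trans (cong 𝟙 (does-⇔ (mk⇔ forward backward) (edge? x y a b ×-dec toℕ a <? toℕ b) (x ≟ a ×-dec y ≟ b)))
          (𝟙-∧ (does (x ≟ a)) (does (y ≟ b)))
    where
    forward : IsEdge x y a b × toℕ a < toℕ b → x ≡ a × y ≡ b
    forward (inj₁ (a≡x , b≡y) , _)      = sym a≡x , sym b≡y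
    forward (inj₂ (refl , refl) , y<x) = ⊥-elim (<-asym x<y y<x)
    backward : x ≡ a × y ≡ b → IsEdge x y a b × toℕ a < toℕ b
    backward (refl , refl) = inj₁ (refl , refl) , x<y

e-insertEdge : ∀ {n} (A : Graph n) {x y : Fin n} (x≢y : x ≢ y) → adj A x y ≡ false → toℕ x < toℕ y →
               e (insertEdge A x y x≢y) ≡ suc (e A)
e-insertEdge A {x} {y} x≢y xy∉A x<y = begin
  e (insertEdge A x y x≢y)                              ≡⟨ e≡edges (insertEdge A x y x≢y) ⟩
  edges (adj (insertEdge A x y x≢y))                    ≡⟨ edges-+ (λ a b → 𝟙-∨ (new∉A ∘ from-does (edge? x y a b))) ⟩
  edges (adj A) + edges (λ a b → does (edge? x y a b))  ≡⟨ cong₂ _+_ (sym (e≡edges A)) (edges-single x<y) ⟩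
  e A + 1                                               ≡⟨ +-comm (e A) 1 ⟩
  suc (e A)                                             ∎
  where
  open ≡-Reasoning
  new∉A : ∀ {a b} → IsEdge x y a b → adj A a b ≡ false
  new∉A (inj₁ (refl , refl)) = xy∉A
  new∉A (inj₂ (refl , refl)) = trans (Graph.sym A y x) xy∉A

insert-missing-edge : ∀ {n} (A B : Graph n) → A ⊆ B → e A < e B → ∃[ A′ ] A ⊆ A′ × A′ ⊆ B × e A′ ≡ suc (e A)
insert-missing-edge A B A⊆B eA<eB with 0<e⇒edge (B ∖ A) room
  where
  room : 0 < e (B ∖ A)
  room = +-cancelʳ-< (e A) 0 (e (B ∖ A)) (subst (e A <_) (e-∖ B A A⊆B) eA<eB)
... | u , v , uv∈B∖A , u<v = insertEdge A u v u≢v , A⊆A′ , A′⊆B , e-insertEdge A u≢v uv∉A u<v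
  where
  u≢v : u ≢ v
  u≢v u≡v = <-irrefl (cong toℕ u≡v) u<v
  uv∉A : adj A u v ≡ false
  uv∉A = not-injective (∧-conicalʳ (adj B u v) (not (adj A u v)) uv∈B∖A)
  A⊆A′ : A ⊆ insertEdge A u v u≢v
  A⊆A′ a b ab∈A = cong (_∨ does (edge? u v a b)) ab∈A
  A′⊆B : insertEdge A u v u≢v ⊆ B
  A′⊆B a b h with ∨-true h
  ... | inj₁ ab∈A = A⊆B a b ab∈A
  ... | inj₂ ab∈uv with from-does (edge? u v a b) ab∈uv
  ...   | inj₁ (a≡u , b≡v) rewrite a≡u | b≡v = ∧-conicalˡ _ _ uv∈B∖A
  ...   | inj₂ (a≡v , b≡u) rewrite a≡v | b≡u = trans (Graph.sym B v u) (∧-conicalˡ _ _ uv∈B∖A)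

interpolate : ∀ {n} (A B : Graph n) → A ⊆ B → ∀ {k} → e A ≤ k → k ≤ e B → ∃[ R ] A ⊆ R × R ⊆ B × e R ≡ k
interpolate A B A⊆B {k} eA≤k k≤eB = grow (k ∸ e A) A A⊆B (m+[n∸m]≡n eA≤k)
  where
  grow : ∀ d A → A ⊆ B → e A + d ≡ k → ∃[ R ] A ⊆ R × R ⊆ B × e R ≡ k
  grow zero    A A⊆B eA+0≡k = A , (λ _ _ h → h) , A⊆B , trans (sym (+-identityʳ (e A))) eA+0≡k
  grow (suc d) A A⊆B eA+d≡k =
    let A′ , A⊆A′ , A′⊆B , eA′ = insert-missing-edge A B A⊆B eA<eB
        R  , A′⊆R , R⊆B  , eR  = grow d A′ A′⊆B (trans (cong (_+ d) eA′) (trans (sym (+-suc (e A) d)) eA+d≡k))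
    in  R , (λ a b h → A′⊆R a b (A⊆A′ a b h)) , R⊆B , eR
    where
    eA<eB : e A < e B
    eA<eB = <-≤-trans (subst (e A <_) eA+d≡k (m<m+n (e A) z<s)) k≤eB

-- Colour classes

record ProperEdgeColouring {n} (H : Graph n) (t : ℕ) : Set where
  field
    colour     : Fin n → Fin n → Fin t
    colour-sym : ∀ u v → colour u v ≡ colour v u
    proper     : ∀ u v w → adj H u v ≡ true → adj H u w ≡ true → colour u v ≡ colour u w → v ≡ w

module ColourClasses {n t} {H : Graph n} (χ : ProperEdgeColouring H t) where
  open ProperEdgeColouring χ

  classes : (Fin t → Bool) → Graph n
  adj       (classes S) u v = S (colour u v) ∧ adj H u v
  Graph.sym (classes S) u v = cong₂ _∧_ (cong S (colour-sym u v)) (Graph.sym H u v)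
  irrefl    (classes S) u rewrite irrefl H u = ∧-zeroʳ (S (colour u u))

  size : Fin t → ℕ
  size γ = edges (λ u v → does (colour u v ≟ γ) ∧ adj H u v)

  classes-mono : ∀ S S′ → (∀ γ → S γ ≡ true → S′ γ ≡ true) → classes S ⊆ classes S′
  classes-mono S S′ S⇒S′ u v h rewrite S⇒S′ (colour u v) (∧-conicalˡ _ _ h) = ∧-conicalʳ _ _ h

  e-classes : ∀ S → e (classes S) ≡ ∑[ γ ∈ S ] size γ
  e-classes S = begin
    e (classes S)                                ≡⟨ e≡edges (classes S) ⟩
    ∑[ u < n ] ∑[ v < n ] 𝟙 ((S (colour u v) ∧ adj H u v) ∧ l u v)
                                                 ≡⟨ sum-cong-≗ (λ u → sum-cong-≗ (sift u)) ⟨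
    ∑[ u < n ] ∑[ v < n ] ∑[ γ < t ] w γ u v     ≡⟨ sum-cong-≗ (λ u → ∑-comm (λ v γ → w γ u v)) ⟩
    ∑[ u < n ] ∑[ γ < t ] ∑[ v < n ] w γ u v     ≡⟨ ∑-comm (λ u γ → ∑[ v < n ] w γ u v) ⟩
    ∑[ γ < t ] ∑[ u < n ] ∑[ v < n ] w γ u v
                                                 ≡⟨ sum-cong-≗ (λ γ → sum-cong-≗ (λ u → *-distribˡ-sum (𝟙 (S γ)) (sized γ u))) ⟨
    ∑[ γ < t ] ∑[ u < n ] (𝟙 (S γ) * sum (sized γ u))
                                                 ≡⟨ sum-cong-≗ (λ γ → *-distribˡ-sum (𝟙 (S γ)) (sum ∘ sized γ)) ⟨
    ∑[ γ ∈ S ] size γ                            ∎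
    where
    open ≡-Reasoning
    l : Fin n → Fin n → Bool
    l u v = toℕ u <ᵇ toℕ v
    sized : Fin t → Fin n → Fin n → ℕ
    sized γ u v = 𝟙 ((does (colour u v ≟ γ) ∧ adj H u v) ∧ l u v)
    w : Fin t → Fin n → Fin n → ℕ
    w γ u v = 𝟙 (S γ) * sized γ u v
    𝟙-∧-∧ : ∀ a b c → 𝟙 ((a ∧ b) ∧ c) ≡ 𝟙 a * 𝟙 (b ∧ c)
    𝟙-∧-∧ a b c = trans (cong 𝟙 (∧-assoc a b c)) (𝟙-∧ a (b ∧ c))
    sift : ∀ u v → ∑[ γ < t ] w γ u v ≡ 𝟙 ((S (colour u v) ∧ adj H u v) ∧ l u v)
    sift u v = begin
      ∑[ γ < t ] (𝟙 (S γ) * sized γ u v)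
                                             ≡⟨ sum-cong-≗ (λ γ → cong (𝟙 (S γ) *_) (𝟙-∧-∧ (is γ) (adj H u v) (l u v))) ⟩
      ∑[ γ < t ] (𝟙 (S γ) * (𝟙 (is γ) * h))  ≡⟨ sum-cong-≗ (λ γ → x∙yz≈y∙xz (𝟙 (S γ)) (𝟙 (is γ)) h) ⟩
      ∑[ γ < t ] (𝟙 (is γ) * (𝟙 (S γ) * h))  ≡⟨ ∑-sift (colour u v) (λ γ → 𝟙 (S γ) * h) ⟩
      𝟙 (S (colour u v)) * h                 ≡⟨ 𝟙-∧-∧ (S (colour u v)) (adj H u v) (l u v) ⟨
      𝟙 ((S (colour u v) ∧ adj H u v) ∧ l u v) ∎
      where
      is : Fin t → Bool
      is γ = does (colour u v ≟ γ)
      h : ℕ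
      h = 𝟙 (adj H u v ∧ l u v)

  e≡∑size : e H ≡ sum size
  e≡∑size = trans (e-classes (λ _ → true)) (sum-cong-≗ (λ γ → +-identityʳ (size γ)))

  deg≤∣colours∣ : ∀ G S → G ⊆ classes S → ∀ u → deg G u ≤ ∣ S ∣
  deg≤∣colours∣ G S G⊆S u = subst (_≤ ∣ S ∣) (sym (deg≡∣adj∣ G u)) (∣∣-injection (colour u) injective into)
    where
    injective : ∀ v w → adj G u v ≡ true → adj G u w ≡ true → colour u v ≡ colour u w → v ≡ w
    injective v w uv uw = proper u v w (∧-conicalʳ _ _ (G⊆S u v uv)) (∧-conicalʳ _ _ (G⊆S u w uw))
    into : ∀ v → adj G u v ≡ true → S (colour u v) ≡ true
    into v uv = ∧-conicalˡ _ _ (G⊆S u v uv)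

-- Vizing's theorem

module Vizing {n} (G : Graph n) where

  Colour : Set
  Colour = Fin (suc (Δ G))

  -- colour is total; its values on uncoloured pairs are irrelevant.
  record PartialColouring : Set where
    field
      coloured   : Graph n
      coloured⊆G : coloured ⊆ G
      colour     : Fin n → Fin n → Colour
      colour-sym : ∀ u v → colour u v ≡ colour v u
      proper     : ∀ u v w → adj coloured u v ≡ true → adj coloured u w ≡ true → colour u v ≡ colour u w → v ≡ w
  open PartialColouring public

  _⊑_ : PartialColouring → PartialColouring → Set
  κ ⊑ κ′ = coloured κ ⊆ coloured κ′

  record ColouredEdge (κ : PartialColouring) (γ : Colour) (u w : Fin n) : Set where
    constructor edge
    field
      present : adj (coloured κ) u w ≡ true
      hue     : colour κ u w ≡ γ

  ColouredEdge-sym : ∀ {κ γ u w} → ColouredEdge κ γ u w → ColouredEdge κ γ w u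
  ColouredEdge-sym {κ} {u = u} {w} (edge uw γ≡) =
    edge (trans (Graph.sym (coloured κ) w u) uw) (trans (colour-sym κ w u) γ≡)

  hue-cong : ∀ {κ γ δ u w} → γ ≡ δ → ColouredEdge κ γ u w → ColouredEdge κ δ u w
  hue-cong refl e = e

  ColouredEdge-unique : ∀ {κ γ u v w} → ColouredEdge κ γ u v → ColouredEdge κ γ u w → v ≡ w
  ColouredEdge-unique {κ} (edge uv γ≡) (edge uw γ≡′) = proper κ _ _ _ uv uw (trans γ≡ (sym γ≡′))

  Missing : PartialColouring → Colour → Fin n → Set
  Missing κ γ u = ∀ w → ¬ ColouredEdge κ γ u w

  neighbour? : ∀ κ γ u → Dec (∃[ w ] ColouredEdge κ γ u w)
  neighbour? κ γ u = any? λ w → map′ (uncurry edge) (λ (edge p q) → p , q)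
                                  ((adj (coloured κ) u w ≟ᵇ true) ×-dec (colour κ u w ≟ γ))

  some-missing : ∀ κ u → ∃[ γ ] Missing κ γ u
  some-missing κ u with all? (λ γ → neighbour? κ γ u)
  ... | no ¬all = let γ , ¬γ = ¬∀⟶∃¬ _ _ (λ γ → neighbour? κ γ u) ¬all in γ , λ w e → ¬γ (w , e)
  ... | yes all = ⊥-elim (<-irrefl refl (begin-strict
        Δ G                       <⟨ n<1+n (Δ G) ⟩
        suc (Δ G)                 ≡⟨ ∣true∣ (suc (Δ G)) ⟨
        ∣ (λ (_ : Colour) → true) ∣ ≤⟨ ∣∣-injection {p = λ _ → true} {q = adj (coloured κ) u} (proj₁ ∘ all) distinct
                                                      (λ γ _ → ColouredEdge.present (proj₂ (all γ))) ⟩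
        ∣ adj (coloured κ) u ∣    ≤⟨ ∣∣-mono (coloured⊆G κ u) ⟩
        ∣ adj G u ∣               ≡⟨ deg≡∣adj∣ G u ⟨
        deg G u                   ≤⟨ deg≤Δ G u ⟩
        Δ G                       ∎))
    where
    open ≤-Reasoning
    distinct : ∀ γ δ → _ → _ → proj₁ (all γ) ≡ proj₁ (all δ) → γ ≡ δ
    distinct γ δ _ _ same =
      trans (sym (ColouredEdge.hue (proj₂ (all γ)))) (trans (cong (colour κ u) same) (ColouredEdge.hue (proj₂ (all δ))))

  module Recolour (κ : PartialColouring) {x y : Fin n} (γ : Colour) (xy∈G : adj G x y ≡ true)
           (γ∉x : Missing κ γ x) (γ∉y : Missing κ γ y) where

    private
      new? : ∀ a b → Dec (IsEdge x y a b)
      new? = edge? x y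

      x≢y : x ≢ y
      x≢y = adj-≢ G xy∈G

      new-at : ∀ {a b} → IsEdge x y a b → Missing κ γ a
      new-at (inj₁ (refl , refl)) = γ∉x
      new-at (inj₂ (refl , refl)) = γ∉y

      new-unique : ∀ {a b b′} → IsEdge x y a b → IsEdge x y a b′ → b ≡ b′
      new-unique (inj₁ (refl , refl)) (inj₁ (_ , refl))    = refl
      new-unique (inj₁ (refl , refl)) (inj₂ (a≡y , _))     = ⊥-elim (x≢y a≡y)
      new-unique (inj₂ (refl , refl)) (inj₁ (a≡x , _))     = ⊥-elim (x≢y (sym a≡x))
      new-unique (inj₂ (refl , refl)) (inj₂ (_ , refl))    = refl

      coloured′ : Graph n
      coloured′ = insertEdge (coloured κ) x y x≢y

      colour′ : Fin n → Fin n → Colour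
      colour′ a b = if does (new? a b) then γ else colour κ a b

      new-colour : ∀ {a b} → IsEdge x y a b → colour′ a b ≡ γ
      new-colour {a} {b} new = cong (if_then γ else colour κ a b) (dec-true (new? a b) new)

      old-colour : ∀ {a b} → ¬ IsEdge x y a b → colour′ a b ≡ colour κ a b
      old-colour {a} {b} old = cong (if_then γ else colour κ a b) (dec-false (new? a b) old)

      old-coloured : ∀ {a b} → ¬ IsEdge x y a b → adj coloured′ a b ≡ adj (coloured κ) a b
      old-coloured {a} {b} old = trans (cong (adj (coloured κ) a b ∨_) (dec-false (new? a b) old)) (∨-identityʳ _)

      proper′ : ∀ a b b′ → adj coloured′ a b ≡ true → adj coloured′ a b′ ≡ true → colour′ a b ≡ colour′ a b′ → b ≡ b′
      proper′ a b b′ ab ab′ same with new? a b | new? a b′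
      ... | yes new | yes new′ = new-unique new new′
      ... | yes new | no old′  = ⊥-elim (new-at new b′ (edge (trans (sym (old-coloured old′)) ab′)
                                   (trans (sym (old-colour old′)) (trans (sym same) (new-colour new)))))
      ... | no old  | yes new′ = ⊥-elim (new-at new′ b (edge (trans (sym (old-coloured old)) ab)
                                   (trans (sym (old-colour old)) (trans same (new-colour new′)))))
      ... | no old  | no old′  = proper κ a b b′ (trans (sym (old-coloured old)) ab)
                                   (trans (sym (old-coloured old′)) ab′)
                                   (trans (sym (old-colour old)) (trans same (old-colour old′)))

    recolour : PartialColouring
    recolour = record
      { coloured   = coloured′
      ; coloured⊆G = λ a b h → [ coloured⊆G κ a b , (λ new → ⊆G (from-does (new? a b) new)) ]′ (∨-true h)
      ; colour     = colour′
      ; colour-sym = λ a b → cong₂ (if_then γ else_) (edge?-sym x y a b) (colour-sym κ a b)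
      ; proper     = proper′
      }
      where
      ⊆G : ∀ {a b} → IsEdge x y a b → adj G a b ≡ true
      ⊆G (inj₁ (refl , refl)) = xy∈G
      ⊆G (inj₂ (refl , refl)) = trans (Graph.sym G y x) xy∈G

    recolour-⊒ : κ ⊑ recolour
    recolour-⊒ a b h = cong (_∨ does (new? a b)) h

    recolour-new : ColouredEdge recolour γ x y
    recolour-new = edge (trans (cong (adj (coloured κ) x y ∨_) (dec-true (new? x y) xy)) (∨-zeroʳ _)) (new-colour xy)
      where
      xy : IsEdge x y x y
      xy = inj₁ (refl , refl)

    recolour-old : ∀ {a b} → ¬ IsEdge x y a b →
                   adj (coloured recolour) a b ≡ adj (coloured κ) a b × colour recolour a b ≡ colour κ a b
    recolour-old old = old-coloured old , old-colour old

    recoloured-edge : ∀ {δ a b} → ColouredEdge recolour δ a b →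
                      (IsEdge x y a b × δ ≡ γ) ⊎ (¬ IsEdge x y a b × ColouredEdge κ δ a b)
    recoloured-edge {δ} {a} {b} (edge ab δ≡) with new? a b
    ... | yes new = inj₁ (new , trans (sym δ≡) (new-colour new))
    ... | no old  = inj₂ (old , edge (trans (sym (old-coloured old)) ab) (trans (sym (old-colour old)) δ≡))

    recolour-away : ∀ {δ a} → a ≢ x → a ≢ y → Missing κ δ a → Missing recolour δ a
    recolour-away a≢x a≢y δ∉a w e with recoloured-edge e
    ... | inj₁ (inj₁ (a≡x , _) , _) = a≢x a≡x
    ... | inj₁ (inj₂ (a≡y , _) , _) = a≢y a≡y
    ... | inj₂ (_ , e′)             = δ∉a w e′

  KempeClosed : PartialColouring → Colour → Colour → (Fin n → Bool) → Set
  KempeClosed κ α β S = ∀ {u w} → S u ≡ true → ColouredEdge κ α u w ⊎ ColouredEdge κ β u w → S w ≡ true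

  module KempeSwap (κ : PartialColouring) {α β : Colour} (α≢β : α ≢ β) (S : Fin n → Bool)
                   (closed : KempeClosed κ α β S) where

    private
      swap : Colour → Colour
      swap = transpose α β

      swap-injective : ∀ {γ δ} → swap γ ≡ swap δ → γ ≡ δ
      swap-injective {γ} {δ} eq =
        trans (sym (transpose-inverse β α)) (trans (cong (transpose β α) eq) (transpose-inverse β α))

      swap-β : swap β ≡ α
      swap-β rewrite dec-false (β ≟ α) (α≢β ∘ sym) | dec-true (β ≟ β) refl = refl

      swap-fix : ∀ {γ} → γ ≢ α → γ ≢ β → swap γ ≡ γ
      swap-fix {γ} γ≢α γ≢β rewrite dec-false (γ ≟ α) γ≢α | dec-false (γ ≟ β) γ≢β = refl

      -- Testing both ends only keeps colour′ symmetric: by closedness an edge leaving S is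
      -- coloured neither α nor β, so transposing its colour would change nothing.
      colour′ : Fin n → Fin n → Colour
      colour′ u w = if S u ∧ S w then swap (colour κ u w) else colour κ u w

      colour-outside : ∀ {u w} → S u ≡ false → colour′ u w ≡ colour κ u w
      colour-outside {u} {w} Su = if-cong (cong (_∧ S w) Su)

      colour-inside : ∀ {u w} → S u ≡ true → adj (coloured κ) u w ≡ true → colour′ u w ≡ swap (colour κ u w)
      colour-inside {u} {w} Su uw with S w in Sw
      ... | true  = if-cong (cong (_∧ true) Su)
      ... | false = trans (if-cong (cong (_∧ false) Su)) (sym (swap-fix ¬α ¬β))
        where
        ¬α : colour κ u w ≢ α
        ¬α c≡α with () ← trans (sym (closed Su (inj₁ (edge uw c≡α)))) Sw
        ¬β : colour κ u w ≢ β
        ¬β c≡β with () ← trans (sym (closed Su (inj₂ (edge uw c≡β)))) Sw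

      proper′ : ∀ u v w → adj (coloured κ) u v ≡ true → adj (coloured κ) u w ≡ true →
                colour′ u v ≡ colour′ u w → v ≡ w
      proper′ u v w uv uw same = proper κ u v w uv uw ([ inside , outside ]′ (true-or-false (S u)))
        where
        inside : S u ≡ true → colour κ u v ≡ colour κ u w
        inside Su = swap-injective (trans (sym (colour-inside Su uv)) (trans same (colour-inside Su uw)))
        outside : S u ≡ false → colour κ u v ≡ colour κ u w
        outside Su = trans (sym (colour-outside Su)) (trans same (colour-outside Su))

    swapped : PartialColouring
    swapped = record
      { coloured   = coloured κ
      ; coloured⊆G = coloured⊆G κ
      ; colour     = colour′
      ; colour-sym = λ u w → cong₂ (λ b c → if b then swap c else c) (∧-comm (S u) (S w)) (colour-sym κ u w)
      ; proper     = proper′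
      }

    swapped-outside-colour : ∀ {u w} → S u ≡ false → colour swapped u w ≡ colour κ u w
    swapped-outside-colour = colour-outside

    swapped-outside : ∀ {γ u} → S u ≡ false → Missing κ γ u → Missing swapped γ u
    swapped-outside Su γ∉u w (edge uw c≡γ) = γ∉u w (edge uw (trans (sym (colour-outside Su)) c≡γ))

    swapped-other : ∀ {γ u} → γ ≢ α → γ ≢ β → Missing κ γ u → Missing swapped γ u
    swapped-other {γ} {u} γ≢α γ≢β γ∉u w (edge uw c≡γ) = γ∉u w (edge uw ([ inside , outside ]′ (true-or-false (S u))))
      where
      inside : S u ≡ true → colour κ u w ≡ γ
      inside Su = swap-injective (trans (sym (colour-inside Su uw)) (trans c≡γ (sym (swap-fix γ≢α γ≢β))))
      outside : S u ≡ false → colour κ u w ≡ γ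
      outside Su = trans (sym (colour-outside Su)) c≡γ

    swapped-inside : ∀ {u} → S u ≡ true → Missing κ β u → Missing swapped α u
    swapped-inside Su β∉u w (edge uw c≡α) =
      β∉u w (edge uw (swap-injective (trans (sym (colour-inside Su uw)) (trans c≡α (sym swap-β)))))

  module AlternatingWalk (κ : PartialColouring) {α β : Colour} (α≢β : α ≢ β) (v : Fin n) (β∉v : Missing κ β v) where

    -- The i-th step of the walk uses colour alt i; it leaves v along α since β is missing at v.
    alt : ℕ → Colour
    alt zero          = α
    alt (suc zero)    = β
    alt (suc (suc i)) = alt i

    alt-≢ : ∀ i → alt i ≢ alt (suc i)
    alt-≢ zero          = α≢β
    alt-≢ (suc zero)    = α≢β ∘ sym
    alt-≢ (suc (suc i)) = alt-≢ i

    alt-αβ : ∀ i → alt i ≡ α ⊎ alt i ≡ β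
    alt-αβ zero          = inj₁ refl
    alt-αβ (suc zero)    = inj₂ refl
    alt-αβ (suc (suc i)) = alt-αβ i

    alt-cover : ∀ i {γ} → γ ≡ α ⊎ γ ≡ β → γ ≡ alt i ⊎ γ ≡ alt (suc i)
    alt-cover zero          γ∈αβ        = γ∈αβ
    alt-cover (suc zero)    (inj₁ γ≡α) = inj₂ γ≡α
    alt-cover (suc zero)    (inj₂ γ≡β) = inj₁ γ≡β
    alt-cover (suc (suc i)) γ∈αβ        = alt-cover i γ∈αβ

    next : Fin n → Colour → Maybe (Fin n)
    next u γ = Data.Maybe.map proj₁ (dec⇒maybe (neighbour? κ γ u))

    next-just : ∀ {u γ w} → next u γ ≡ just w → ColouredEdge κ γ u w
    next-just {u} {γ} eq with neighbour? κ γ u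
    ... | yes (w , e) with refl ← eq = e

    next-complete : ∀ {u γ w} → ColouredEdge κ γ u w → next u γ ≡ just w
    next-complete {u} {γ} e with neighbour? κ γ u
    ... | yes (w′ , e′) = cong just (ColouredEdge-unique e′ e)
    ... | no none       = ⊥-elim (none (_ , e))

    next-missing : ∀ {u γ} → Missing κ γ u → next u γ ≡ nothing
    next-missing {u} {γ} γ∉u with neighbour? κ γ u
    ... | yes (w , e) = ⊥-elim (γ∉u w e)
    ... | no _        = refl

    walk : ℕ → Maybe (Fin n)
    walk zero    = just v
    walk (suc i) = walk i >>= λ u → next u (alt i)

    walk-step : ∀ i {w} → walk (suc i) ≡ just w → ∃[ u ] walk i ≡ just u × ColouredEdge κ (alt i) u w
    walk-step i eq with walk i
    ... | just u = u , refl , next-just eq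

    walk-extend : ∀ i {u w} → walk i ≡ just u → ColouredEdge κ (alt i) u w → walk (suc i) ≡ just w
    walk-extend i eq e rewrite eq = next-complete e

    walk-stop : ∀ i {u} → walk i ≡ just u → Missing κ (alt i) u → walk (suc i) ≡ nothing
    walk-stop i eq γ∉u rewrite eq = next-missing γ∉u

    walk-prefix : ∀ {i j w} → i ≤ j → walk j ≡ just w → ∃[ u ] walk i ≡ just u
    walk-prefix {j = j} i≤j eq with m≤n⇒m<n∨m≡n i≤j
    ... | inj₂ refl = _ , eq
    walk-prefix {j = suc j} i≤j eq | inj₁ i<j = walk-prefix (≤-pred i<j) (proj₁ (proj₂ (walk-step j eq)))

    no-loop : ∀ {γ u} → ¬ ColouredEdge κ γ u u
    no-loop (edge uu _) = adj-≢ (coloured κ) uu refl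

    -- Every vertex has at most one edge of each colour, so a vertex seen again would have to be
    -- re-entered along an edge the walk already used, or be v, which has no β-edge.
    walk-injective : ∀ j i {u} → i < j → walk i ≡ just u → walk j ≡ just u → ⊥
    walk-injective (suc j) i {u} i<j wᵢ wⱼ with walk-step j wⱼ
    ... | p , wp , p─u with i
    ...   | zero with refl ← just-injective wᵢ with alt-αβ j
    ...     | inj₂ β≡ = β∉v p (ColouredEdge-sym (hue-cong β≡ p─u))
    ...     | inj₁ α≡ with j
    ...       | zero         = no-loop (subst (λ w → ColouredEdge κ α w u) (just-injective (sym wp)) p─u)
    ...       | suc zero     = α≢β (sym α≡)
    ...       | suc (suc j′) = walk-injective (suc (suc j′)) 1 (s≤s (s≤s z≤n))
                                 (walk-extend 0 wᵢ (ColouredEdge-sym (hue-cong α≡ p─u))) wp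
    walk-injective (suc j) i {u} i<j wᵢ wⱼ | p , wp , p─u | suc i′ with walk-step i′ wᵢ
    ... | q , wq , q─u with alt-cover i′ (alt-αβ j)
    ...   | inj₁ same = walk-injective j i′ (≤-pred i<j) wq (subst (λ w → walk j ≡ just w) p≡q wp)
      where
      p≡q : p ≡ q
      p≡q = ColouredEdge-unique (ColouredEdge-sym p─u) (ColouredEdge-sym (hue-cong (sym same) q─u))
    ...   | inj₂ next with <-cmp (suc (suc i′)) j
    ...     | tri< i+1<j _ _ =
      walk-injective j (suc (suc i′)) i+1<j (walk-extend (suc i′) wᵢ (ColouredEdge-sym (hue-cong next p─u))) wp
    ...     | tri≈ _ refl _  = alt-≢ (suc i′) (sym next)
    ...     | tri> _ _ j<i+1 with ≤-antisym (≤-pred j<i+1) (≤-pred i<j)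
    ...       | refl = no-loop (subst (λ w → ColouredEdge κ (alt j) w u) (just-injective (trans (sym wp) wᵢ)) p─u)

    walk-ends : walk n ≡ nothing
    walk-ends with walk n in wₙ
    ... | nothing = refl
    ... | just w₀ with pigeonhole (n<1+n n) vertex
      where
      vertex : Fin (suc n) → Fin n
      vertex i = Data.Maybe.fromMaybe w₀ (walk (toℕ i))
    ... | i , j , i<j , same =
      ⊥-elim (walk-injective (toℕ j) (toℕ i) i<j (visits i) (trans (visits j) (cong just (sym same))))
      where
      visits : ∀ i → walk (toℕ i) ≡ just (Data.Maybe.fromMaybe w₀ (walk (toℕ i)))
      visits i with walk-prefix (toℕ≤pred[n] i) wₙ
      ... | u , wᵢ rewrite wᵢ = refl

    walk-bounded : ∀ i {u} → walk i ≡ just u → i < n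
    walk-bounded i wᵢ with i <? n
    ... | yes i<n = i<n
    ... | no i≮n with () ← trans (sym (proj₂ (walk-prefix (≮⇒≥ i≮n) wᵢ))) walk-ends

    OnWalk : Fin n → Set
    OnWalk u = Σ[ i ∈ Fin n ] walk (toℕ i) ≡ just u

    onWalk? : ∀ u → Dec (OnWalk u)
    onWalk? u = any? λ i → Data.Maybe.Properties.≡-dec _≟_ (walk (toℕ i)) (just u)

    onWalk : ∀ i {u} → walk i ≡ just u → OnWalk u
    onWalk i wᵢ = fromℕ< (walk-bounded i wᵢ) , trans (cong walk (toℕ-fromℕ< (walk-bounded i wᵢ))) wᵢ

    start : OnWalk v
    start = onWalk 0 refl

    onWalk-step : ∀ {u w γ} → OnWalk u → γ ≡ α ⊎ γ ≡ β → ColouredEdge κ γ u w → OnWalk w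
    onWalk-step (i , wᵢ) γ∈αβ u─w with alt-cover (toℕ i) γ∈αβ
    ... | inj₁ γ≡ = onWalk (suc (toℕ i)) (walk-extend (toℕ i) wᵢ (hue-cong γ≡ u─w))
    ... | inj₂ γ≡ with toℕ i | wᵢ
    ...   | zero  | wᵢ′ with refl ← just-injective wᵢ′ = ⊥-elim (β∉v _ (hue-cong γ≡ u─w))
    ...   | suc k | wᵢ′ with walk-step k wᵢ′
    ...     | q , w_q , q─u with refl ← ColouredEdge-unique (hue-cong γ≡ u─w) (ColouredEdge-sym q─u) = onWalk k w_q

    onWalk-closed : ∀ {u w} → OnWalk u → ColouredEdge κ α u w ⊎ ColouredEdge κ β u w → OnWalk w
    onWalk-closed u∈ (inj₁ u─w) = onWalk-step u∈ (inj₁ refl) u─w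
    onWalk-closed u∈ (inj₂ u─w) = onWalk-step u∈ (inj₂ refl) u─w

    walk-closed : KempeClosed κ α β (does ∘ onWalk?)
    walk-closed {u} {w} u∈ u─w = dec-true (onWalk? w) (onWalk-closed (from-does (onWalk? u) u∈) u─w)

    walk-reaches : (P : Fin n → Set) → (∀ {u w} → P u → ColouredEdge κ α u w ⊎ ColouredEdge κ β u w → P w) →
                   ∀ {u} → OnWalk u → P u → P v
    walk-reaches P closed (i , wᵢ) = back (toℕ i) wᵢ
      where
      back : ∀ i {u} → walk i ≡ just u → P u → P v
      back zero    wᵢ Pu with refl ← just-injective wᵢ = Pu
      back (suc i) wᵢ Pu with walk-step i wᵢ
      ... | q , w_q , q─u =
        back i w_q (closed Pu (Data.Sum.map (λ α≡ → ColouredEdge-sym (hue-cong α≡ q─u))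
                                            (λ β≡ → ColouredEdge-sym (hue-cong β≡ q─u)) (alt-αβ i)))

    Deficient : Fin n → Set
    Deficient u = Missing κ α u ⊎ Missing κ β u

    deficient-last : ∀ i {a} → walk i ≡ just a → a ≢ v → Deficient a → walk (suc i) ≡ nothing
    deficient-last zero    wᵢ a≢v _ = ⊥-elim (a≢v (just-injective (sym wᵢ)))
    deficient-last (suc i) {a} wᵢ a≢v deficient with walk-step i wᵢ
    ... | q , _ , q─a = walk-stop (suc i) wᵢ (missing-next deficient)
      where
      missing-other : ∀ {γ} → γ ≡ α ⊎ γ ≡ β → Missing κ γ a → Missing κ (alt (suc i)) a
      missing-other γ∈αβ γ∉a with alt-cover i γ∈αβ
      ... | inj₁ refl = ⊥-elim (γ∉a q (ColouredEdge-sym q─a))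
      ... | inj₂ refl = γ∉a
      missing-next : Deficient a → Missing κ (alt (suc i)) a
      missing-next (inj₁ α∉a) = missing-other (inj₁ refl) α∉a
      missing-next (inj₂ β∉a) = missing-other (inj₂ refl) β∉a

    last-unique : ∀ i j {a b} → walk i ≡ just a → walk (suc i) ≡ nothing →
                  walk j ≡ just b → walk (suc j) ≡ nothing → i ≡ j
    last-unique i j wᵢ endᵢ wⱼ endⱼ with <-cmp i j
    ... | tri≈ _ i≡j _ = i≡j
    ... | tri< i<j _ _ with () ← trans (sym (proj₂ (walk-prefix i<j wⱼ))) endᵢ
    ... | tri> _ _ j<i with () ← trans (sym (proj₂ (walk-prefix j<i wᵢ))) endⱼ

    -- A vertex other than v that misses α or β ends the walk.
    deficient-unique : ∀ {a b} → OnWalk a → OnWalk b → a ≢ v → b ≢ v → Deficient a → Deficient b → a ≡ b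
    deficient-unique (i , wᵢ) (j , wⱼ) a≢v b≢v a-def b-def = just-injective (trans (sym wᵢ) (trans (cong walk i≡j) wⱼ))
      where
      i≡j : toℕ i ≡ toℕ j
      i≡j = last-unique (toℕ i) (toℕ j) wᵢ (deficient-last (toℕ i) wᵢ a≢v a-def)
                                        wⱼ (deficient-last (toℕ j) wⱼ b≢v b-def)

  Extension : PartialColouring → Fin n → Fin n → Set
  Extension κ x y = ∃[ κ′ ] κ ⊑ κ′ × adj (coloured κ′) x y ≡ true

  record Fan (κ : PartialColouring) (x : Fin n) (y : ℕ → Fin n) (k : ℕ) : Set where
    field
      spoke₀        : adj G x (y 0) ≡ true
      uncoloured₀   : adj (coloured κ) x (y 0) ≡ false
      spoke         : ∀ j → j < k → adj (coloured κ) x (y (suc j)) ≡ true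
      spoke-missing : ∀ j → j < k → Missing κ (colour κ x (y (suc j))) (y j)
      distinct      : ∀ i j → i ≤ k → j ≤ k → y i ≡ y j → i ≡ j
      ≢centre       : ∀ j → j ≤ k → y j ≢ x

  fan-prefix : ∀ {κ x y m k} → m ≤ k → Fan κ x y k → Fan κ x y m
  fan-prefix m≤k F = record
    { spoke₀        = spoke₀
    ; uncoloured₀   = uncoloured₀
    ; spoke         = λ j j<m → spoke j (<-≤-trans j<m m≤k)
    ; spoke-missing = λ j j<m → spoke-missing j (<-≤-trans j<m m≤k)
    ; distinct      = λ i j i≤m j≤m → distinct i j (≤-trans i≤m m≤k) (≤-trans j≤m m≤k)
    ; ≢centre       = λ j j≤m → ≢centre j (≤-trans j≤m m≤k)
    }
    where open Fan F

  rotate : ∀ k {κ x y γ} → Fan κ x y k → Missing κ γ x → Missing κ γ (y k) → Extension κ x (y 0)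
  rotate zero {κ} {γ = γ} F γ∉x γ∉y₀ = recolour , recolour-⊒ , ColouredEdge.present recolour-new
    where open Recolour κ γ (Fan.spoke₀ F) γ∉x γ∉y₀
  rotate (suc k) {κ} {x} {y} {γ} F γ∉x γ∉yₖ₊₁ =
    let κ′ , κ₁⊑κ′ , done = rotate k F₁ β∉x β∉yₖ in κ′ , (λ a b h → κ₁⊑κ′ a b (K₁.recolour-⊒ a b h)) , done
    where
    open Fan F
    β : Colour
    β = colour κ x (y (suc k))
    module K₁ = Recolour κ γ (coloured⊆G κ x (y (suc k)) (spoke k ≤-refl)) γ∉x γ∉yₖ₊₁
    κ₁ : PartialColouring
    κ₁ = K₁.recolour
    y≢yₖ₊₁ : ∀ {j} → j ≤ k → y j ≢ y (suc k)
    y≢yₖ₊₁ {j} j≤k same = 1+n≰n (subst (_≤ k) (distinct j (suc k) (m≤n⇒m≤1+n j≤k) ≤-refl same) j≤k)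
    untouched : ∀ {j} → j ≤ k → ¬ IsEdge x (y (suc k)) x (y j)
    untouched j≤k (inj₁ (_ , same))     = y≢yₖ₊₁ j≤k same
    untouched j≤k (inj₂ (x≡yₖ₊₁ , _))   = ≢centre (suc k) ≤-refl (sym x≡yₖ₊₁)
    away : ∀ {j} → j ≤ k → ∀ {δ} → Missing κ δ (y j) → Missing κ₁ δ (y j)
    away j≤k = K₁.recolour-away (≢centre _ (m≤n⇒m≤1+n j≤k)) (y≢yₖ₊₁ j≤k)
    F₁ : Fan κ₁ x y k
    F₁ = record
      { spoke₀        = spoke₀
      ; uncoloured₀   = trans (proj₁ (K₁.recolour-old (untouched z≤n))) uncoloured₀
      ; spoke         = λ j j<k → K₁.recolour-⊒ _ _ (spoke j (m≤n⇒m≤1+n j<k))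
      ; spoke-missing = λ j j<k → subst (λ δ → Missing κ₁ δ (y j)) (sym (proj₂ (K₁.recolour-old (untouched j<k))))
                                    (away (<⇒≤ j<k) (spoke-missing j (m≤n⇒m≤1+n j<k)))
      ; distinct      = λ i j i≤k j≤k → distinct i j (m≤n⇒m≤1+n i≤k) (m≤n⇒m≤1+n j≤k)
      ; ≢centre       = λ j j≤k → ≢centre j (m≤n⇒m≤1+n j≤k)
      }
    β∉x : Missing κ₁ β x
    β∉x w e with K₁.recoloured-edge e
    ... | inj₁ (_ , β≡γ)    = γ∉x (y (suc k)) (edge (spoke k ≤-refl) β≡γ)
    ... | inj₂ (other , e′) with refl ← ColouredEdge-unique (edge (spoke k ≤-refl) refl) e′ =
      other (inj₁ (refl , refl))
    β∉yₖ : Missing κ₁ β (y k)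
    β∉yₖ = away ≤-refl (spoke-missing k ≤-refl)

  spoke-colours-distinct : ∀ {κ x y k} → Fan κ x y k → ∀ {i j} → i < k → j < k →
                           colour κ x (y (suc i)) ≡ colour κ x (y (suc j)) → i ≡ j
  spoke-colours-distinct {κ} {x} {y} F {i} {j} i<k j<k same =
    suc-injective (distinct (suc i) (suc j) i<k j<k (proper κ x _ _ (spoke i i<k) (spoke j j<k) same))
    where open Fan F

  kempe-rotate : ∀ {κ x y k α β} → Fan κ x y k → (α≢β : α ≢ β) → Missing κ α x →
                 (S : Fin n → Bool) (closed : KempeClosed κ α β S) → S x ≡ false →
                 ∀ m → m ≤ k → S (y m) ≡ true → Missing κ β (y m) →
                 (∀ j → j < m → colour κ x (y (suc j)) ≡ β → S (y j) ≡ false) → Extension κ x (y 0)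
  kempe-rotate {κ} {x} {y} {k} {α} {β} F α≢β α∉x S closed Sx m m≤k Sym β∉yₘ guard =
    rotate m F′ (swapped-outside Sx α∉x) (swapped-inside Sym β∉yₘ)
    where
    open KempeSwap κ α≢β S closed
    open Fan (fan-prefix m≤k F)
    kept : ∀ j → j < m → Missing swapped (colour κ x (y (suc j))) (y j)
    kept j j<m with colour κ x (y (suc j)) ≟ β
    ... | yes c≡β = swapped-outside (guard j j<m c≡β) (spoke-missing j j<m)
    ... | no  c≢β = swapped-other (λ c≡α → α∉x _ (edge (spoke j j<m) c≡α)) c≢β (spoke-missing j j<m)
    F′ : Fan swapped x y m
    F′ = record
      { spoke₀        = spoke₀
      ; uncoloured₀   = uncoloured₀
      ; spoke         = spoke
      ; spoke-missing = λ j j<m → subst (λ δ → Missing swapped δ (y j)) (sym (swapped-outside-colour Sx)) (kept j j<m)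
      ; distinct      = distinct
      ; ≢centre       = ≢centre
      }

  snoc : (ℕ → Fin n) → ℕ → Fin n → ℕ → Fin n
  snoc y k z j = if does (j ≤? k) then y j else z

  snoc-old : ∀ y z {k j} → j ≤ k → snoc y k z j ≡ y j
  snoc-old y z {k} {j} j≤k = if-cong (dec-true (j ≤? k) j≤k)

  snoc-new : ∀ y k z → snoc y k z (suc k) ≡ z
  snoc-new y k z = if-cong (dec-false (suc k ≤? k) 1+n≰n)

  fan-snoc : ∀ {κ x y k z} → Fan κ x y k → adj (coloured κ) x z ≡ true → Missing κ (colour κ x z) (y k) →
             (∀ i → i ≤ k → y i ≢ z) → Fan κ x (snoc y k z) (suc k)
  fan-snoc {κ} {x} {y} {k} {z} F xz fresh-colour fresh = record
    { spoke₀        = subst (λ w → adj G x w ≡ true) (sym (old z≤n)) spoke₀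
    ; uncoloured₀   = subst (λ w → adj (coloured κ) x w ≡ false) (sym (old z≤n)) uncoloured₀
    ; spoke         = spoke′
    ; spoke-missing = spoke-missing′
    ; distinct      = distinct′
    ; ≢centre       = ≢centre′
    }
    where
    open Fan F
    y′ = snoc y k z
    old : ∀ {j} → j ≤ k → y′ j ≡ y j
    old = snoc-old y z
    new : y′ (suc k) ≡ z
    new = snoc-new y k z
    cases : ∀ {j} → j ≤ suc k → j ≤ k ⊎ j ≡ suc k
    cases j≤ = Data.Sum.map₁ ≤-pred (m≤n⇒m<n∨m≡n j≤)
    spoke′ : ∀ j → j < suc k → adj (coloured κ) x (y′ (suc j)) ≡ true
    spoke′ j j<k+1 with cases j<k+1
    ... | inj₁ j+1≤k = subst (λ w → adj (coloured κ) x w ≡ true) (sym (old j+1≤k)) (spoke j j+1≤k)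
    ... | inj₂ refl  = subst (λ w → adj (coloured κ) x w ≡ true) (sym new) xz
    spoke-missing′ : ∀ j → j < suc k → Missing κ (colour κ x (y′ (suc j))) (y′ j)
    spoke-missing′ j j<k+1 rewrite old (≤-pred j<k+1) with cases j<k+1
    ... | inj₁ j+1≤k = subst (λ w → Missing κ (colour κ x w) (y j)) (sym (old j+1≤k)) (spoke-missing j j+1≤k)
    ... | inj₂ refl  = subst (λ w → Missing κ (colour κ x w) (y k)) (sym new) fresh-colour
    distinct′ : ∀ i j → i ≤ suc k → j ≤ suc k → y′ i ≡ y′ j → i ≡ j
    distinct′ i j i≤ j≤ same with cases i≤ | cases j≤
    ... | inj₁ i≤k | inj₁ j≤k = distinct i j i≤k j≤k (trans (sym (old i≤k)) (trans same (old j≤k)))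
    ... | inj₁ i≤k | inj₂ refl = ⊥-elim (fresh i i≤k (trans (sym (old i≤k)) (trans same new)))
    ... | inj₂ refl | inj₁ j≤k = ⊥-elim (fresh j j≤k (trans (sym (old j≤k)) (trans (sym same) new)))
    ... | inj₂ refl | inj₂ refl = refl
    ≢centre′ : ∀ j → j ≤ suc k → y′ j ≢ x
    ≢centre′ j j≤ with cases j≤
    ... | inj₁ j≤k = ≢centre j j≤k ∘ trans (sym (old j≤k))
    ... | inj₂ refl = λ z≡x → adj-≢ (coloured κ) xz (sym (trans (sym new) z≡x))

  module Extend (κ : PartialColouring) {x y₀ : Fin n} (xy₀∈G : adj G x y₀ ≡ true)
                (uncoloured : adj (coloured κ) x y₀ ≡ false) where

    free : Fin n → Colour
    free u = proj₁ (some-missing κ u)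

    free-missing : ∀ u → Missing κ (free u) u
    free-missing u = proj₂ (some-missing κ u)

    -- For the colour β missing at y k, the β-edge at x is the spoke to y (i + 1), so β is also
    -- missing at y i, while α is missing at x. Swap α and β on the walk from y k if it avoids x;
    -- otherwise the walk from y i avoids x, as x and y i would both be deficient ends of the walk
    -- from y k.
    module _ {y k} (F : Fan κ x y k) (i : ℕ) (i<k : i < k) (cᵢ≡β : colour κ x (y (suc i)) ≡ free (y k)) where
      open Fan F

      private
        α≢β : free x ≢ free (y k)
        α≢β α≡β = free-missing x (y (suc i)) (edge (spoke i i<k) (trans cᵢ≡β (sym α≡β)))

        β∉yᵢ : Missing κ (free (y k)) (y i)
        β∉yᵢ = subst (λ δ → Missing κ δ (y i)) cᵢ≡β (spoke-missing i i<k)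

        below-i : ∀ {S : Fin n → Bool} j → j < i → colour κ x (y (suc j)) ≡ free (y k) → S (y j) ≡ false
        below-i j j<i cⱼ≡β =
          ⊥-elim (<-irrefl (spoke-colours-distinct F (<-trans j<i i<k) i<k (trans cⱼ≡β (sym cᵢ≡β))) j<i)

        module P = AlternatingWalk κ α≢β (y k) (free-missing (y k))
        module Q = AlternatingWalk κ α≢β (y i) β∉yᵢ

        x∉Q : P.OnWalk x → ¬ Q.OnWalk x
        x∉Q x∈P x∈Q =
          ≢centre i (<⇒≤ i<k) (sym (P.deficient-unique x∈P yᵢ∈P x≢yₖ yᵢ≢yₖ (inj₁ (free-missing x)) (inj₂ β∉yᵢ)))
          where
          yᵢ∈P : P.OnWalk (y i)
          yᵢ∈P = Q.walk-reaches P.OnWalk P.onWalk-closed x∈Q x∈P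
          x≢yₖ : x ≢ y k
          x≢yₖ = ≢centre k ≤-refl ∘ sym
          yᵢ≢yₖ : y i ≢ y k
          yᵢ≢yₖ same = <-irrefl (distinct i k (<⇒≤ i<k) ≤-refl same) i<k

      kempe-case : Extension κ x (y 0)
      kempe-case with P.onWalk? x | P.onWalk? (y i)
      ... | yes x∈P | _ =
        kempe-rotate F α≢β (free-missing x) (does ∘ Q.onWalk?) Q.walk-closed (dec-false (Q.onWalk? x) (x∉Q x∈P))
          i (<⇒≤ i<k) (dec-true (Q.onWalk? (y i)) Q.start) β∉yᵢ (below-i {does ∘ Q.onWalk?})
      ... | no x∉P | yes yᵢ∈P =
        kempe-rotate F α≢β (free-missing x) (does ∘ P.onWalk?) P.walk-closed (dec-false (P.onWalk? x) x∉P)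
          i (<⇒≤ i<k) (dec-true (P.onWalk? (y i)) yᵢ∈P) β∉yᵢ (below-i {does ∘ P.onWalk?})
      ... | no x∉P | no yᵢ∉P =
        kempe-rotate F α≢β (free-missing x) (does ∘ P.onWalk?) P.walk-closed (dec-false (P.onWalk? x) x∉P)
          k ≤-refl (dec-true (P.onWalk? (y k)) P.start) (free-missing (y k)) only-i
        where
        only-i : ∀ j → j < k → colour κ x (y (suc j)) ≡ free (y k) → does (P.onWalk? (y j)) ≡ false
        only-i j j<k cⱼ≡β with refl ← spoke-colours-distinct F j<k i<k (trans cⱼ≡β (sym cᵢ≡β)) =
          dec-false (P.onWalk? (y i)) yᵢ∉P

    grow : ∀ d {y k} → n ≤ k + d → Fan κ x y k → Extension κ x (y 0)
    grow zero {y} {k} n≤k F with pigeonhole (s≤s (subst (n ≤_) (+-identityʳ k) n≤k)) (λ (i : Fin (suc k)) → y (toℕ i))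
    ... | i , j , i<j , same =
      ⊥-elim (<-irrefl (Fan.distinct F (toℕ i) (toℕ j) (toℕ≤pred[n] i) (toℕ≤pred[n] j) same) i<j)
    grow (suc d) {y} {k} n≤ F with neighbour? κ (free (y k)) x
    ... | no none = rotate k F (λ w e → none (w , e)) (free-missing (y k))
    ... | yes (z , edge xz hue) with any? (λ (i : Fin (suc k)) → y (toℕ i) ≟ z)
    ...   | yes (i , yᵢ≡z) = revisit (toℕ i) (toℕ≤pred[n] i) yᵢ≡z
      where
      revisit : ∀ i → i ≤ k → y i ≡ z → Extension κ x (y 0)
      revisit zero     _     refl with () ← trans (sym xz) (Fan.uncoloured₀ F)
      revisit (suc i′) i′<k  refl = kempe-case F i′ i′<k hue
    ...   | no  fresh =
      let κ′ , κ⊑κ′ , done = grow d (subst (n ≤_) (+-suc k d) n≤) F′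
      in  κ′ , κ⊑κ′ , subst (λ w → adj (coloured κ′) x w ≡ true) (snoc-old y z {k} z≤n) done
      where
      F′ : Fan κ x (snoc y k z) (suc k)
      F′ = fan-snoc F xz (subst (λ δ → Missing κ δ (y k)) (sym hue) (free-missing (y k)))
             λ i i≤k yᵢ≡z → fresh (fromℕ< (s≤s i≤k) , trans (cong y (toℕ-fromℕ< (s≤s i≤k))) yᵢ≡z)

    extend : Extension κ x y₀
    extend = grow n ≤-refl fan₀
      where
      fan₀ : Fan κ x (λ _ → y₀) 0
      fan₀ = record
        { spoke₀        = xy₀∈G
        ; uncoloured₀   = uncoloured
        ; spoke         = λ _ ()
        ; spoke-missing = λ _ ()
        ; distinct      = λ i j i≤0 j≤0 _ → trans (n≤0⇒n≡0 i≤0) (sym (n≤0⇒n≡0 j≤0))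
        ; ≢centre       = λ _ _ y₀≡x → adj-≢ G xy₀∈G (sym y₀≡x)
        }

  colour-all : ∀ N κ → e (G ∖ coloured κ) < N → Σ[ κ′ ∈ PartialColouring ] G ⊆ coloured κ′
  colour-all (suc N) κ bound with 0 <? e (G ∖ coloured κ)
  ... | no  none = κ , edgeless-∖⇒⊆ G (coloured κ) none
  ... | yes some =
    let x , y , xy∈G∖κ , _ = 0<e⇒edge (G ∖ coloured κ) some
        κ′ , κ⊑κ′ , xy∈κ′ = Extend.extend κ (∧-conicalˡ _ _ xy∈G∖κ) (not-injective (∧-conicalʳ _ _ xy∈G∖κ))
        fewer = e-mono-< (G ∖ coloured κ′) (G ∖ coloured κ) (∖-antitone G (coloured κ) (coloured κ′) κ⊑κ′) xy∈G∖κ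
                  (subst (λ b → adj G x y ∧ not b ≡ false) (sym xy∈κ′) (∧-zeroʳ _))
    in  colour-all N κ′ (<-≤-trans fewer (≤-pred bound))

  empty-colouring : PartialColouring
  empty-colouring = record
    { coloured   = record { adj = λ _ _ → false ; sym = λ _ _ → refl ; irrefl = λ _ → refl }
    ; coloured⊆G = λ _ _ ()
    ; colour     = λ _ _ → zero
    ; colour-sym = λ _ _ → refl
    ; proper     = λ _ _ _ ()
    }

  vizing : ProperEdgeColouring G (suc (Δ G))
  vizing =
    let ∅ = coloured empty-colouring
        κ , complete = colour-all (suc (e G)) empty-colouring (s≤s (e-mono (G ∖ ∅) G (∖-⊆ G ∅)))
    in  record
      { colour     = colour κ
      ; colour-sym = colour-sym κ
      ; proper     = λ u v w uv uw → proper κ u v w (complete u v uv) (complete u w uw)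
      }

-- Choosing the heaviest colour classes

module Selection {t} (s : Fin t → ℕ) where

  Separated : (Fin t → Bool) → ℕ → Set
  Separated S m = (∀ γ → S γ ≡ true → m ≤ s γ) × (∀ γ → S γ ≡ false → s γ ≤ m)

  separated-average : ∀ {S m} → Separated S m → ∣ S ∣ * sum s ≤ t * ∑[ γ ∈ S ] s γ
  separated-average {S} {m} (heavy , light) = begin
    j * sum s            ≡⟨ cong (j *_) (∑-split S s) ⟩
    j * (P + Q)          ≡⟨ *-distribˡ-+ j P Q ⟩
    j * P + j * Q        ≤⟨ +-monoʳ-≤ (j * P) (*-monoʳ-≤ j Q≤rm) ⟩
    j * P + j * (r * m)  ≡⟨ cong (j * P +_) (x∙yz≈y∙xz j r m) ⟩
    j * P + r * (j * m)  ≤⟨ +-monoʳ-≤ (j * P) (*-monoʳ-≤ r jm≤P) ⟩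
    j * P + r * P        ≡⟨ *-distribʳ-+ P j r ⟨
    (j + r) * P          ≡⟨ cong (_* P) (∣∣-complement S) ⟩
    t * P                ∎
    where
    open ≤-Reasoning
    j = ∣ S ∣
    r = ∣ not ∘ S ∣
    P = ∑[ γ ∈ S ] s γ
    Q = ∑[ γ ∈ not ∘ S ] s γ
    jm≤P : j * m ≤ P
    jm≤P = subst (_≤ P) (∑∈-const S m) (∑∈-mono-≤ heavy)
    Q≤rm : Q ≤ r * m
    Q≤rm = subst (Q ≤_) (∑∈-const (not ∘ S) m) (∑∈-mono-≤ (λ γ ¬Sγ → light γ (not-injective ¬Sγ)))

  heaviest-unchosen : ∀ {S k} → ∑[ γ ∈ S ] s γ ≤ k → k < sum s →
                      ∃[ γ ] S γ ≡ false × (∀ δ → S δ ≡ false → s δ ≤ s γ)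
  heaviest-unchosen {S} {k} P≤k k<∑ = γ , Sγ , λ δ Sδ → subst₂ _≤_ (unchosen Sδ) (unchosen Sγ) (≤rest δ)
    where
    rest : Fin t → ℕ
    rest δ = 𝟙 (not (S δ)) * s δ
    unchosen : ∀ {δ} → S δ ≡ false → rest δ ≡ s δ
    unchosen Sδ rewrite Sδ = +-identityʳ _
    0<rest : 0 < sum rest
    0<rest = +-cancelˡ-< (∑[ γ ∈ S ] s γ) 0 (sum rest)
               (≤-<-trans (≤-reflexive (+-identityʳ _)) (≤-<-trans P≤k (subst (k <_) (∑-split S s) k<∑)))
    witness = sum-positive rest 0<rest
    heaviest = argmax (proj₁ witness) rest
    γ = proj₁ heaviest
    ≤rest = proj₂ heaviest
    Sγ : S γ ≡ false
    Sγ with S γ in eq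
    ... | false = refl
    ... | true  =
      ⊥-elim (<⇒≱ (proj₂ witness) (≤-trans (≤rest (proj₁ witness)) (≤-reflexive (cong (λ b → 𝟙 (not b) * s γ) eq))))

  record Selected (k : ℕ) : Set where
    field
      chosen  : Fin t → Bool
      next    : Fin t
      next∉   : chosen next ≡ false
      below   : ∑[ γ ∈ chosen ] s γ ≤ k
      above   : k ≤ ∑[ γ ∈ chosen ] s γ + s next
      average : ∣ chosen ∣ * sum s ≤ t * ∑[ γ ∈ chosen ] s γ

  select : ∀ {k} → k < sum s → Selected k
  select {k} k<∑ = grow (suc t) (λ _ → false) (max s) (s≤s (∣∣≤n _)) ((λ _ ()) , λ γ _ → ≤max s γ)
                        (subst (_≤ k) (sym (sum-replicate-zero t)) z≤n)
    where
    -- m is the size of the class chosen last; r bounds the number of unchosen classes.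
    grow : ∀ r S m → ∣ not ∘ S ∣ < r → Separated S m → ∑[ γ ∈ S ] s γ ≤ k → Selected k
    grow (suc r) S m unchosen<r (heavy , light) P≤k with heaviest-unchosen P≤k k<∑
    ... | γ , Sγ , heaviest with k ≤? ∑[ δ ∈ S ] s δ + s γ
    ...   | yes k≤ = record { chosen = S ; next = γ ; next∉ = Sγ ; below = P≤k ; above = k≤
                            ; average = separated-average (heavy , light) }
    ...   | no  k≰ = grow r (insert γ S) (s γ) fewer (heavy′ , light′)
                       (subst (_≤ k) (sym (∑∈-insert S s Sγ)) (<⇒≤ (≰⇒> k≰)))
      where
      fewer : ∣ not ∘ insert γ S ∣ < r
      fewer = <-≤-trans (∣∣-mono-< shrink γ (cong (λ b → not (b ∨ S γ)) (dec-true (γ ≟ γ) refl)) (cong not Sγ))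
                        (≤-pred unchosen<r)
        where
        shrink : ∀ δ → not (insert γ S δ) ≡ true → not (S δ) ≡ true
        shrink δ h with does (γ ≟ δ) | S δ
        ... | false | false = refl
      heavy′ : ∀ δ → insert γ S δ ≡ true → s γ ≤ s δ
      heavy′ δ h with γ ≟ δ
      ... | yes refl = ≤-refl
      ... | no _     = ≤-trans (light γ Sγ) (heavy δ h)
      light′ : ∀ δ → insert γ S δ ≡ false → s δ ≤ s γ
      light′ δ h = heaviest δ (∨-conicalʳ _ _ h)

-- Removing colour classes

spread-bound : ∀ {a b d D j r} → j + r ≡ suc D → d ≤ D → a ≤ r → d ∸ suc j ≤ b → a ∸ b ≤ (D ∸ d) + 2
spread-bound {a} {b} {d} {D} {j} {r} j+r≡ d≤D a≤r d∸≤b = m≤n+o⇒m∸n≤o a b (+-cancelˡ-≤ j a _ (begin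
  j + a                       ≤⟨ +-monoʳ-≤ j a≤r ⟩
  j + r                       ≡⟨ j+r≡ ⟩
  suc D                       ≡⟨ cong suc (m+[n∸m]≡n d≤D) ⟨
  suc (d + (D ∸ d))           ≤⟨ s≤s (+-monoˡ-≤ (D ∸ d) d≤) ⟩
  suc (suc j + b + (D ∸ d))   ≡⟨ rearrange j b (D ∸ d) ⟩
  j + (b + (D ∸ d + 2))       ∎))
  where
  open ≤-Reasoning
  d≤ : d ≤ suc j + b
  d≤ = ≤-trans (m≤n+m∸n d (suc j)) (+-monoʳ-≤ (suc j) d∸≤b)
  rearrange : ∀ j b x → suc (suc j + b + x) ≡ j + (b + (x + 2))
  rearrange = solve-∀

module ClassRemoval {n} (H : Graph (suc n)) {m} (0<m : 0 < m) (m≤e : m ≤ e H) where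
  open ProperEdgeColouring (Vizing.vizing H) using (colour)
  open ColourClasses (Vizing.vizing H)
  open Selection size

  k : ℕ
  k = e H ∸ m

  open Selected (select (subst (k <_) e≡∑size (∸-monoʳ-< 0<m m≤e)))

  j : ℕ
  j = ∣ chosen ∣

  A B : Graph (suc n)
  A = classes chosen
  B = classes (insert next chosen)

  ∣B∣ : ∣ insert next chosen ∣ ≡ suc j
  ∣B∣ = ∣∣-insert chosen next∉

  private
    between : ∃[ R ] A ⊆ R × R ⊆ B × e R ≡ k
    between = interpolate A B A⊆B (subst (_≤ k) (sym (e-classes chosen)) below)
                (subst (k ≤_) (sym (trans (e-classes (insert next chosen)) (∑∈-insert chosen size next∉))) above)
      where
      A⊆B : A ⊆ B
      A⊆B = classes-mono chosen (insert next chosen) λ γ h → trans (cong (does (next ≟ γ) ∨_) h) (∨-zeroʳ _)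

  R : Graph (suc n)
  R = proj₁ between

  A⊆R : A ⊆ R
  A⊆R = proj₁ (proj₂ between)

  R⊆B : R ⊆ B
  R⊆B = proj₁ (proj₂ (proj₂ between))

  eR≡k : e R ≡ k
  eR≡k = proj₂ (proj₂ (proj₂ between))

  R⊆H : R ⊆ H
  R⊆H u v h = ∧-conicalʳ _ _ (R⊆B u v h)

  H′ : Graph (suc n)
  H′ = H ∖ R

  eH′≡m : e H′ ≡ m
  eH′≡m = begin
    e H′                ≡⟨ m+n∸n≡m (e H′) (e R) ⟨
    e H′ + e R ∸ e R    ≡⟨ cong₂ _∸_ (e-∖ H R R⊆H) (sym eR≡k) ⟨
    e H ∸ k             ≡⟨ m∸[m∸n]≡n m≤e ⟩
    m                   ∎
    where open ≡-Reasoning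

  H′⊆unchosen : H′ ⊆ classes (not ∘ chosen)
  H′⊆unchosen u v h = subst (λ b → not b ∧ adj H u v ≡ true) (sym unchosen) uv∈H
    where
    uv∈H : adj H u v ≡ true
    uv∈H = ∧-conicalˡ (adj H u v) (not (adj R u v)) h
    unchosen : chosen (colour u v) ≡ false
    unchosen = ¬-not λ c → case trans (sym (∧-conicalʳ (adj H u v) (not (adj R u v)) h))
                                      (cong not (A⊆R u v (trans (cong (_∧ adj H u v) c) uv∈H))) of λ ()

  deg-R : ∀ u → deg R u ≤ suc j
  deg-R u = subst (deg R u ≤_) ∣B∣ (deg≤∣colours∣ R (insert next chosen) R⊆B u)

  δ-H′ : δ H ∸ suc j ≤ δ H′
  δ-H′ = δ-greatest H′ λ u → m≤n+o⇒m∸n≤o (δ H) (suc j) (begin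
    δ H                    ≤⟨ δ≤deg H u ⟩
    deg H u                ≡⟨ deg-∖ H R R⊆H u ⟩
    deg H′ u + deg R u     ≤⟨ +-monoʳ-≤ (deg H′ u) (deg-R u) ⟩
    deg H′ u + suc j       ≡⟨ +-comm (deg H′ u) (suc j) ⟩
    suc j + deg H′ u       ∎)
    where open ≤-Reasoning

  spread : Δ H′ ∸ δ H′ ≤ (Δ H ∸ δ H) + 2
  spread = spread-bound (∣∣-complement chosen) (≤-trans (δ≤deg H zero) (deg≤Δ H zero))
             (Δ-least H′ (deg≤∣colours∣ H′ (not ∘ chosen) H′⊆unchosen)) δ-H′

  Δ-removed : Δ (H ∖ H′) ≤ suc j
  Δ-removed = Δ-least (H ∖ H′) λ u →
    subst (deg (H ∖ H′) u ≤_) ∣B∣ (deg≤∣colours∣ (H ∖ H′) (insert next chosen) (λ a b h → R⊆B a b (∖∖-⊆ H R a b h)) u)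

  removed : e H * Δ (H ∖ H′) ≤ (Δ H + 1) * (e H ∸ m) + e H
  removed = begin
    e H * Δ (H ∖ H′)                          ≤⟨ *-monoʳ-≤ (e H) Δ-removed ⟩
    e H * suc j                               ≡⟨ *-suc (e H) j ⟩
    e H + e H * j                             ≡⟨ cong (λ x → e H + x * j) e≡∑size ⟩
    e H + sum size * j                        ≡⟨ cong (e H +_) (*-comm (sum size) j) ⟩
    e H + j * sum size                        ≤⟨ +-monoʳ-≤ (e H) average ⟩
    e H + suc (Δ H) * ∑[ γ ∈ chosen ] size γ  ≤⟨ +-monoʳ-≤ (e H) (*-monoʳ-≤ (suc (Δ H)) below) ⟩
    e H + suc (Δ H) * k                       ≡⟨ +-comm (e H) _ ⟩
    suc (Δ H) * k + e H                       ≡⟨ cong (λ x → x * k + e H) (+-comm 1 (Δ H)) ⟩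
    (Δ H + 1) * (e H ∸ m) + e H               ∎
    where open ≤-Reasoning

lemma4p1 : (n : ℕ) (H : Graph n) (m : ℕ) → 0 < e H → 0 < m → m ≤ e H →
    Σ (Graph n) (λ H' → (H' ⊆ H) × (e H' ≡ m)
      × (Δ H' ∸ δ H' ≤ (Δ H ∸ δ H) + 2)
      × (e H * Δ (H ∖ H') ≤ (Δ H + 1) * (e H ∸ m) + e H))
lemma4p1 zero    H m () _ _
lemma4p1 (suc n) H m _ 0<m m≤e = H′ , ∖-⊆ H R , eH′≡m , spread , removed
  where open ClassRemoval H 0<m m≤e
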